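{- Let $T$ be a tableau of shape $\lambda\vdash n$ whose entries are $1,\dots,n$, each appearing once, let $1\le i<j\le\lambda_1$ and $k\in\{1,\dots,|C_j|\}$. Write ${\bf a_b}=T(a,b)$ and $$\alpha_{i,{\bf k_j}}=\sum_{t=1}^{|C_i|}({\bf t_i},{\bf k_j})\in\mathbb{Q}S_n.$$ Then $\alpha_{i,{\bf k_j}}\gamma_T=\gamma_T$.
   Context: Young diagrams are in French convention: cells $(a,b)$ with row $a$ counted from the bottom and column $b$. $C_b$ (resp. $R_a$) is the set of entries in column $b$ (resp. row $a$) of $T$. For $U\subseteq\{1,\dots,n\}$, $[U]=\sum_{\sigma\in S_U}\sigma$, $[U]'=\sum_{\sigma\in S_U}\mathrm{sgn}(\sigma)\sigma$, with $S_U$ the permutations fixing everything outside $U$. $N(T)=\prod_b[C_b]'$, $P(T)=\prod_a[R_a]$, $f_\lambda$ is the number of standard tableaux of shape $\lambda$, and $\gamma_T=\frac{f_\lambda}{n!}N(T)P(T)$. -}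

module Defs where

open import Function using (_∘_; id)
open import Data.Bool using (Bool; true; false; _∧_; _∨_; not; if_then_else_)
open import Data.Nat as ℕ using (ℕ; zero; suc; _!; _<ᵇ_; _≡ᵇ_; _%_)
open import Data.Nat.Properties using (_!≢0)
open import Data.Fin as Fin using (Fin; toℕ; _≟_)
open import Data.List using (List; []; _∷_; [_]; map; concat; concatMap; filterᵇ;
  mapMaybe; length; allFin; foldr; upTo)
open import Data.Bool.ListAction using (all; any)
open import Data.List.Relation.Unary.All using (All)
open import Data.List.Relation.Unary.Linked using (Linked)
open import Data.List.Relation.Binary.Permutation.Propositional using (_↭_)
open import Data.Maybe using (Maybe; just; nothing)
open import Data.Product using (_×_; _,_; proj₁)
open import Data.Rational as ℚ using (ℚ; 0ℚ; 1ℚ)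
open import Data.Integer using (+_)
open import Relation.Nullary.Decidable using (⌊_⌋)
open import Relation.Binary.PropositionalEquality using (_≡_)

-- Permutations of {1,…,n}, encoded (0-based) as maps Fin n → Fin n.
-- The genuine permutations are the injective ones, enumerated in allPerms.

Perm : ℕ → Set
Perm n = Fin n → Fin n

_==_ : ∀ {n} → Fin n → Fin n → Bool
x == y = ⌊ x ≟ y ⌋

samePermᵇ : ∀ {n} → Perm n → Perm n → Bool
samePermᵇ {n} σ τ = all (λ x → σ x == τ x) (allFin n)

allFuns : ∀ m n → List (Fin m → Fin n)
allFuns zero    n = [ (λ ()) ]
allFuns (suc m) n =
  concatMap (λ f → map (λ y → λ { Fin.zero → y ; (Fin.suc i) → f i }) (allFin n))
            (allFuns m n)

injectiveᵇ : ∀ {n} → Perm n → Bool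
injectiveᵇ {n} σ =
  all (λ i → all (λ j → not (σ i == σ j) ∨ (i == j)) (allFin n)) (allFin n)

allPerms : ∀ n → List (Perm n)
allPerms n = filterᵇ injectiveᵇ (allFuns n n)

inversions : ∀ {n} → Perm n → ℕ
inversions {n} σ =
  length (concatMap (λ i → filterᵇ (λ j → (toℕ i <ᵇ toℕ j) ∧ (toℕ (σ j) <ᵇ toℕ (σ i)))
                                    (allFin n))
                    (allFin n))

sgn : ∀ {n} → Perm n → ℚ
sgn σ = if (inversions σ % 2) ≡ᵇ 0 then 1ℚ else ℚ.- 1ℚ

swap : ∀ {n} → Fin n → Fin n → Perm n
swap x y z = if z == x then y else (if z == y then x else z)

-- The group algebra ℚ S_n: formal ℚ-linear combinations of permutations.
-- Product: (σ τ)(x) = σ (τ x).  Two elements are equal iff every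
-- permutation has the same total coefficient.

QS : ℕ → Set
QS n = List (ℚ × Perm n)

infixl 7 _·_
_·_ : ∀ {n} → QS n → QS n → QS n
x · y = concatMap (λ { (a , σ) → map (λ { (b , τ) → (a ℚ.* b , σ ∘ τ) }) y }) x

sumℚ : List ℚ → ℚ
sumℚ = foldr ℚ._+_ 0ℚ

coeff : ∀ {n} → QS n → Perm n → ℚ
coeff x π = sumℚ (map proj₁ (filterᵇ (λ { (_ , σ) → samePermᵇ σ π }) x))

infix 4 _≈_
_≈_ : ∀ {n} → QS n → QS n → Set
_≈_ {n} x y = (π : Perm n) → coeff x π ≡ coeff y π

one : ∀ {n} → QS n
one = [ (1ℚ , id) ]

prodQS : ∀ {n} → List (QS n) → QS n
prodQS = foldr _·_ one

scale : ∀ {n} → ℚ → QS n → QS n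
scale c = map (λ { (a , σ) → (c ℚ.* a , σ) })

memᵇ : ∀ {n} → Fin n → List (Fin n) → Bool
memᵇ x U = any (λ u → u == x) U

S_ : ∀ {n} → List (Fin n) → List (Perm n)
S_ {n} U = filterᵇ (λ σ → all (λ x → memᵇ x U ∨ (σ x == x)) (allFin n)) (allPerms n)

sym[_] : ∀ {n} → List (Fin n) → QS n
sym[ U ] = map (λ σ → (1ℚ , σ)) (S U)

asym[_] : ∀ {n} → List (Fin n) → QS n
asym[ U ] = map (λ σ → (sgn σ , σ)) (S U)

-- Tableaux (French convention): T is the list of its rows, the first
-- element being the bottom row (row 1).  Entries 1,…,n are encoded as
-- Fin n (entry m ↔ Fin element m-1).  Cell (a,b) (1-based) is the
-- (b-1)-th element of the (a-1)-th row.

Tableau : ℕ → Set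
Tableau n = List (List (Fin n))

shape : ∀ {n} → Tableau n → List ℕ
shape = map length

IsPartition : List ℕ → Set
IsPartition λ′ = Linked ℕ._≥_ λ′ × All (ℕ._<_ 0) λ′

IsTableau : ∀ n → Tableau n → Set
IsTableau n T = IsPartition (shape T) × (concat T ↭ allFin n)

nth : ∀ {A : Set} → List A → ℕ → Maybe A
nth []       _       = nothing
nth (x ∷ xs) zero    = just x
nth (x ∷ xs) (suc i) = nth xs i

λ₁ : ∀ {n} → Tableau n → ℕ
λ₁ []      = 0
λ₁ (r ∷ _) = length r

-- column b (0-based), listed from the bottom row upward: C_{b+1}
col : ∀ {n} → Tableau n → ℕ → List (Fin n)
col T b = mapMaybe (λ r → nth r b) T

N : ∀ {n} → Tableau n → QS n
N T = prodQS (map (λ b → asym[ col T b ]) (upTo (λ₁ T)))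

P : ∀ {n} → Tableau n → QS n
P T = prodQS (map sym[_] T)

fill : ∀ {A : Set} → List ℕ → List A → List (List A)
fill []        xs = []
fill (l ∷ ls)  xs = take′ l xs ∷ fill ls (drop′ l xs)
  where
  take′ : ∀ {A : Set} → ℕ → List A → List A
  take′ zero    _        = []
  take′ (suc k) []       = []
  take′ (suc k) (y ∷ ys) = y ∷ take′ k ys
  drop′ : ∀ {A : Set} → ℕ → List A → List A
  drop′ zero    ys       = ys
  drop′ (suc k) []       = []
  drop′ (suc k) (y ∷ ys) = drop′ k ys

increasingᵇ : ∀ {n} → List (Fin n) → Bool
increasingᵇ []           = true
increasingᵇ (x ∷ [])     = true
increasingᵇ (x ∷ y ∷ ys) = (toℕ x <ᵇ toℕ y) ∧ increasingᵇ (y ∷ ys)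

standardᵇ : ∀ {n} → Tableau n → Bool
standardᵇ T = all increasingᵇ T ∧ all (λ b → increasingᵇ (col T b)) (upTo (λ₁ T))

-- f_λ: number of standard tableaux of shape λ with entries 1,…,n
-- (every filling of λ by 1,…,n is fill λ (σ(1),…,σ(n)) for a unique σ ∈ S_n)
f : ∀ n → List ℕ → ℕ
f n λ′ = length (filterᵇ (λ σ → standardᵇ (fill λ′ (map σ (allFin n)))) (allPerms n))

γ : ∀ {n} → Tableau n → QS n
γ {n} T = scale (ℚ._/_ (+ f n (shape T)) (n !) {{n !≢0}}) (N T · P T)

-- α_{i,k_j} = Σ_t (t_i, k_j), where y = k_j = T(k,j) and i is 0-based column index
α : ∀ {n} → Tableau n → ℕ → Fin n → QS n
α T i y = map (λ x → (1ℚ , swap x y)) (col T i)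

module Submission where

-- Write α = Σ_{t ∈ C_i} (t y) with y an entry of column j > i, and split N(T) = A [C_i]' B,
-- where A and B are the products of the column antisymmetrisers left and right of column i.
-- Every permutation occurring in A fixes C_i ∪ {y}, so α commutes with A.  The coset
-- decomposition of S_{C_i ∪ {y}} over S_{C_i} reads [C_i ∪ {y}]' = [C_i]' - α [C_i]', so it
-- suffices that [C_i ∪ {y}]' B P(T) = 0.  For a permutation q occurring in B, z = q⁻¹(y) lies
-- in column j and shares a row with some w ∈ C_i; then (w z) P(T) = P(T) and q (w z) = (w y) q,
-- hence [C_i ∪ {y}]' q P(T) = [C_i ∪ {y}]' (w y) q P(T) = - [C_i ∪ {y}]' q P(T) = 0.

open import Algebra.Bundles using (CommutativeRing)
open import Algebra.Structures using (IsCommutativeSemiring; IsCommutativeRing)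
open import Data.Bool using (Bool; true; false; _∧_; _∨_; not; _xor_; if_then_else_; T; T?)
open import Data.Bool.ListAction using (all)
import Data.Bool.Properties as BoolP
open import Data.Empty using (⊥; ⊥-elim)
open import Data.Fin as Fin using (Fin; _≟_; toℕ)
import Data.Fin.Properties as FinP
import Data.Integer as ℤ
open import Data.List
  using (List; []; _∷_; _++_; _∷ʳ_; upTo; lookup; map; mapMaybe; foldr; concat; concatMap; filterᵇ;
         allFin; tabulate; length)
open import Data.List.Membership.Propositional using (_∈_; _∉_)
open import Data.List.Membership.Propositional.Properties using (∈-allFin; ∈-++⁺ˡ; ∈-++⁺ʳ; ∈-lookup)
open import Data.List.Properties using (map-tabulate)
import Data.List.Properties as ListP
open import Data.List.Relation.Binary.Disjoint.Propositional using (Disjoint)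
open import Data.List.Relation.Binary.Permutation.Propositional using (↭-sym; ↭⇒↭ₛ)
import Data.List.Relation.Binary.Permutation.Setoid.Properties as PermSetoidP
open import Data.List.Relation.Unary.All as All using (All; []; _∷_)
import Data.List.Relation.Unary.All.Properties as AllP
open import Data.List.Relation.Unary.AllPairs using ([]; _∷_)
open import Data.List.Relation.Unary.Any using (Any; here; there)
open import Data.List.Relation.Unary.Unique.Propositional using (Unique)
open import Data.List.Relation.Unary.Unique.Propositional.Properties using (allFin⁺)
open import Data.Maybe using (just; nothing)
open import Data.Nat using (ℕ; zero; suc; _<_; z<s; s<s; _<ᵇ_; _≡ᵇ_; _%_; parity)
import Data.Nat as Nat
import Data.Nat.DivMod as ℕDM
import Data.Nat.Properties as ℕP
open import Data.Parity.Base as ℙ using (Parity; 0ℙ; 1ℙ)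
import Data.Parity.Properties as ℙP
open import Data.Product using (_×_; _,_; proj₁; proj₂; ∃)
open import Data.Rational as ℚ using (ℚ; 0ℚ; 1ℚ)
import Data.Rational.Properties as ℚP
open import Data.Sum using (_⊎_; inj₁; inj₂)
open import Function using (_∘_; id; case_of_)
open import Function.Bundles using (Equivalence)
open import Function.Definitions using (Injective)
open import Level using (0ℓ)
open import Relation.Binary.Bundles using (Setoid)
open import Relation.Binary.Definitions using (tri<; tri≈; tri>)
open import Relation.Binary.PropositionalEquality
import Relation.Binary.Reasoning.Setoid as SetoidReasoning
open import Relation.Nullary using (Dec; yes; no; ¬_)
open ≡-Reasoning

open import Defs

==⇒≡ : ∀ {n} {x y : Fin n} → (x == y) ≡ true → x ≡ y
==⇒≡ {x = x} {y} _ with x ≟ y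
... | yes x≡y = x≡y

≡⇒== : ∀ {n} {x y : Fin n} → x ≡ y → (x == y) ≡ true
≡⇒== {x = x} {y} x≡y with x ≟ y
... | yes _   = refl
... | no x≢y = ⊥-elim (x≢y x≡y)

≢⇒== : ∀ {n} {x y : Fin n} → x ≢ y → (x == y) ≡ false
≢⇒== {x = x} {y} x≢y with x ≟ y
... | yes x≡y = ⊥-elim (x≢y x≡y)
... | no _    = refl

==-refl : ∀ {n} (x : Fin n) → (x == x) ≡ true
==-refl x = ≡⇒== refl

true⇔⇒≡ : ∀ {a b : Bool} → (a ≡ true → b ≡ true) → (b ≡ true → a ≡ true) → a ≡ b
true⇔⇒≡ {true}  {true}  _ _ = refl
true⇔⇒≡ {true}  {false} f _ = sym (f refl)
true⇔⇒≡ {false} {true}  _ g = g refl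
true⇔⇒≡ {false} {false} _ _ = refl

all≡true⇒ : ∀ {A : Set} (p : A → Bool) xs → all p xs ≡ true → ∀ {x} → x ∈ xs → p x ≡ true
all≡true⇒ p (y ∷ ys) e (here refl) with p y | e
... | true | _ = refl
all≡true⇒ p (y ∷ ys) e (there x∈) with p y | e
... | true | e′ = all≡true⇒ p ys e′ x∈

all≡true⇐ : ∀ {A : Set} (p : A → Bool) xs → (∀ {x} → x ∈ xs → p x ≡ true) → all p xs ≡ true
all≡true⇐ p []       _ = refl
all≡true⇐ p (y ∷ ys) f rewrite f (here refl) = all≡true⇐ p ys (f ∘ there)

∉⇒≢ : ∀ {A : Set} {xs : List A} {x u} → u ∈ xs → x ∉ xs → x ≢ u
∉⇒≢ u∈xs x∉xs refl = x∉xs u∈xs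

Unique-++⁻ : ∀ {A : Set} (xs : List A) {ys} → Unique (xs ++ ys) → Unique xs × Unique ys × Disjoint xs ys
Unique-++⁻ []       u = [] , u , λ ()
Unique-++⁻ (x ∷ xs) (x∉ ∷ u) with Unique-++⁻ xs u
... | u-xs , u-ys , disjoint = AllP.++⁻ˡ xs x∉ ∷ u-xs , u-ys , λ where
  (here refl , x∈ys) → All.lookup (AllP.++⁻ʳ xs x∉) x∈ys refl
  (there v∈xs , v∈ys) → disjoint (v∈xs , v∈ys)

∈-concat⁺ : ∀ {A : Set} {x : A} {xss : List (List A)} {P : List A → Set} →
            (∀ {xs} → P xs → x ∈ xs) → Any P xss → x ∈ concat xss
∈-concat⁺ {xss = xs ∷ _}  P⇒∈ (here p)  = ∈-++⁺ˡ (P⇒∈ p)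
∈-concat⁺ {xss = xs ∷ _}  P⇒∈ (there a) = ∈-++⁺ʳ xs (∈-concat⁺ P⇒∈ a)

module _ {n : ℕ} where

  swap-β₁ : (a b : Fin n) → swap a b a ≡ b
  swap-β₁ a b rewrite ==-refl a = refl

  swap-β₂ : (a b : Fin n) → swap a b b ≡ a
  swap-β₂ a b with b == a in e
  ... | true  = ==⇒≡ e
  ... | false rewrite ==-refl b = refl

  swap-fixes : (a b x : Fin n) → x ≢ a → x ≢ b → swap a b x ≡ x
  swap-fixes a b x x≢a x≢b rewrite ≢⇒== x≢a | ≢⇒== x≢b = refl

  data SwapView (a b x : Fin n) : Set where
    at-a      : x ≡ a → SwapView a b x
    at-b      : x ≡ b → SwapView a b x
    elsewhere : x ≢ a → x ≢ b → SwapView a b x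

  swapView : (a b x : Fin n) → SwapView a b x
  swapView a b x with x ≟ a | x ≟ b
  ... | yes x≡a | _       = at-a x≡a
  ... | no _    | yes x≡b = at-b x≡b
  ... | no x≢a  | no x≢b  = elsewhere x≢a x≢b

  swap-involutive : (a b x : Fin n) → swap a b (swap a b x) ≡ x
  swap-involutive a b x with swapView a b x
  ... | at-a refl = trans (cong (swap a b) (swap-β₁ a b)) (swap-β₂ a b)
  ... | at-b refl = trans (cong (swap a b) (swap-β₂ a b)) (swap-β₁ a b)
  ... | elsewhere x≢a x≢b =
    trans (cong (swap a b) (swap-fixes a b x x≢a x≢b)) (swap-fixes a b x x≢a x≢b)

  swap-injective : (a b : Fin n) → Injective _≡_ _≡_ (swap a b)
  swap-injective a b {x} {y} e =
    trans (sym (swap-involutive a b x)) (trans (cong (swap a b) e) (swap-involutive a b y))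

  swap-conjugate : ∀ {ρ : Perm n} → Injective _≡_ _≡_ ρ → (c d : Fin n) →
                   ρ ∘ swap c d ≗ swap (ρ c) (ρ d) ∘ ρ
  swap-conjugate {ρ} ρ-inj c d x with swapView c d x
  ... | at-a refl = trans (cong ρ (swap-β₁ c d)) (sym (swap-β₁ (ρ c) (ρ d)))
  ... | at-b refl = trans (cong ρ (swap-β₂ c d)) (sym (swap-β₂ (ρ c) (ρ d)))
  ... | elsewhere x≢c x≢d = trans (cong ρ (swap-fixes c d x x≢c x≢d))
    (sym (swap-fixes (ρ c) (ρ d) (ρ x) (x≢c ∘ ρ-inj) (x≢d ∘ ρ-inj)))

-- Sums over lists in a commutative semiring

module ListSum {A : Set} {_+_ _*_ : A → A → A} {0# 1# : A}
               (isCS : IsCommutativeSemiring _≡_ _+_ _*_ 0# 1#) where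

  open IsCommutativeSemiring isCS
    using (+-assoc; +-comm; +-identityˡ; +-identityʳ; *-comm; *-identityˡ; zeroˡ; zeroʳ; distribˡ)

  infix 8 ∑

  ∑ : {X : Set} → List X → (X → A) → A
  ∑ xs f = foldr _+_ 0# (map f xs)

  syntax ∑ xs (λ x → e) = ∑[ x ← xs ] e

  𝟙 : Bool → A
  𝟙 b = if b then 1# else 0#

  𝟙-∧ : ∀ a b → 𝟙 (a ∧ b) ≡ 𝟙 a * 𝟙 b
  𝟙-∧ true  b = sym (*-identityˡ (𝟙 b))
  𝟙-∧ false b = sym (zeroˡ (𝟙 b))

  module _ {X : Set} where

    ∑-cong : ∀ (xs : List X) {f g} → f ≗ g → ∑ xs f ≡ ∑ xs g
    ∑-cong []       _   = refl
    ∑-cong (x ∷ xs) f≗g = cong₂ _+_ (f≗g x) (∑-cong xs f≗g)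

    ∑-cong-All : ∀ {xs : List X} {f g} → All (λ x → f x ≡ g x) xs → ∑ xs f ≡ ∑ xs g
    ∑-cong-All []       = refl
    ∑-cong-All (e ∷ es) = cong₂ _+_ e (∑-cong-All es)

    ∑-zero : ∀ (xs : List X) → ∑[ _ ← xs ] 0# ≡ 0#
    ∑-zero []       = refl
    ∑-zero (x ∷ xs) = trans (+-identityˡ _) (∑-zero xs)

    ∑-zero-All : ∀ {xs : List X} {f} → All (λ x → f x ≡ 0#) xs → ∑ xs f ≡ 0#
    ∑-zero-All {xs} vanish = trans (∑-cong-All vanish) (∑-zero xs)

    ∑-++ : ∀ (xs ys : List X) f → ∑ (xs ++ ys) f ≡ ∑ xs f + ∑ ys f
    ∑-++ []       ys f = sym (+-identityˡ _)
    ∑-++ (x ∷ xs) ys f = trans (cong (f x +_) (∑-++ xs ys f)) (sym (+-assoc _ _ _))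

    ∑-distrib-+ : ∀ (xs : List X) f g → ∑[ x ← xs ] (f x + g x) ≡ ∑ xs f + ∑ xs g
    ∑-distrib-+ []       f g = sym (+-identityˡ 0#)
    ∑-distrib-+ (x ∷ xs) f g = begin
      (f x + g x) + (∑[ x ← xs ] (f x + g x)) ≡⟨ cong ((f x + g x) +_) (∑-distrib-+ xs f g) ⟩
      (f x + g x) + (∑ xs f + ∑ xs g)         ≡⟨ +-assoc (f x) (g x) _ ⟩
      f x + (g x + (∑ xs f + ∑ xs g))         ≡⟨ cong (f x +_) (sym (+-assoc (g x) _ _)) ⟩
      f x + ((g x + ∑ xs f) + ∑ xs g)         ≡⟨ cong (λ u → f x + (u + ∑ xs g)) (+-comm (g x) _) ⟩
      f x + ((∑ xs f + g x) + ∑ xs g)         ≡⟨ cong (f x +_) (+-assoc (∑ xs f) (g x) _) ⟩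
      f x + (∑ xs f + (g x + ∑ xs g))         ≡⟨ sym (+-assoc (f x) _ _) ⟩
      (f x + ∑ xs f) + (g x + ∑ xs g)         ∎

    ∑-distribˡ : ∀ (xs : List X) c f → ∑[ x ← xs ] (c * f x) ≡ c * ∑ xs f
    ∑-distribˡ []       c f = sym (zeroʳ c)
    ∑-distribˡ (x ∷ xs) c f = trans (cong ((c * f x) +_) (∑-distribˡ xs c f)) (sym (distribˡ c _ _))

    ∑-distribʳ : ∀ (xs : List X) c f → ∑[ x ← xs ] (f x * c) ≡ ∑ xs f * c
    ∑-distribʳ xs c f =
      trans (∑-cong xs (λ x → *-comm (f x) c)) (trans (∑-distribˡ xs c f) (*-comm c _))

    ∑-filterᵇ : ∀ (xs : List X) p f → ∑ (filterᵇ p xs) f ≡ ∑[ x ← xs ] (𝟙 (p x) * f x)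
    ∑-filterᵇ []       p f = refl
    ∑-filterᵇ (x ∷ xs) p f with p x
    ... | true  = cong₂ _+_ (sym (*-identityˡ (f x))) (∑-filterᵇ xs p f)
    ... | false = trans (∑-filterᵇ xs p f)
                        (trans (sym (+-identityˡ _)) (cong (_+ (∑[ x ← xs ] (𝟙 (p x) * f x))) (sym (zeroˡ (f x)))))

    ∑-unique-support : ∀ {xs : List X} {f} {x₀} → Unique xs → x₀ ∈ xs →
                       (∀ {x} → x ∈ xs → x ≢ x₀ → f x ≡ 0#) → ∑ xs f ≡ f x₀
    ∑-unique-support {x ∷ xs} {f} (x∉xs ∷ _) (here refl) vanish =
      trans (cong (f x +_) (∑-zero-All (All.tabulate λ x′∈ → vanish (there x′∈) λ where
               refl → All.lookup x∉xs x′∈ refl)))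
            (+-identityʳ (f x))
    ∑-unique-support {x ∷ xs} {f} (x∉xs ∷ u) (there x₀∈) vanish =
      trans (cong₂ _+_ (vanish (here refl) λ where refl → All.lookup x∉xs x₀∈ refl)
                       (∑-unique-support u x₀∈ (vanish ∘ there)))
            (+-identityˡ _)

  module _ {X Y : Set} where

    ∑-map : ∀ (xs : List X) (g : X → Y) f → ∑ (map g xs) f ≡ ∑ xs (f ∘ g)
    ∑-map []       g f = refl
    ∑-map (x ∷ xs) g f = cong (f (g x) +_) (∑-map xs g f)

    ∑-concatMap : ∀ (xs : List X) (g : X → List Y) f →
                  ∑ (concatMap g xs) f ≡ ∑[ x ← xs ] ∑ (g x) f
    ∑-concatMap []       g f = refl
    ∑-concatMap (x ∷ xs) g f =
      trans (∑-++ (g x) (concatMap g xs) f) (cong (∑ (g x) f +_) (∑-concatMap xs g f))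

    ∑-comm : ∀ (xs : List X) (ys : List Y) (k : X → Y → A) →
             ∑[ x ← xs ] ∑[ y ← ys ] k x y ≡ ∑[ y ← ys ] ∑[ x ← xs ] k x y
    ∑-comm []       ys k = sym (∑-zero ys)
    ∑-comm (x ∷ xs) ys k = trans (cong (∑ ys (k x) +_) (∑-comm xs ys k))
                                 (sym (∑-distrib-+ ys (k x) λ y → ∑[ x ← xs ] k x y))

    ∑∑-distrib-+ : ∀ (xs : List X) (ys : List Y) (f g : X → Y → A) →
                   ∑[ x ← xs ] ∑[ y ← ys ] (f x y + g x y)
                   ≡ (∑[ x ← xs ] ∑[ y ← ys ] f x y) + (∑[ x ← xs ] ∑[ y ← ys ] g x y)
    ∑∑-distrib-+ xs ys f g = trans (∑-cong xs λ x → ∑-distrib-+ ys (f x) (g x))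
                                   (∑-distrib-+ xs (λ x → ∑[ y ← ys ] f x y) (λ x → ∑[ y ← ys ] g x y))

  ∑-tabulate : ∀ {m} {X : Set} (g : Fin m → X) f → ∑ (tabulate g) f ≡ ∑ (allFin m) (f ∘ g)
  ∑-tabulate g f = cong (foldr _+_ 0#) (trans (map-tabulate g f) (sym (map-tabulate id (f ∘ g))))

  ∑-𝟙-== : ∀ {m} (c : Fin m) → ∑[ y ← allFin m ] 𝟙 (y == c) ≡ 1#
  ∑-𝟙-== {suc m} Fin.zero = begin
    1# + ∑ (tabulate (Fin.suc {m})) (λ y → 𝟙 (y == Fin.zero))
      ≡⟨ cong (1# +_) (∑-tabulate {m} Fin.suc λ y → 𝟙 (y == Fin.zero)) ⟩
    1# + (∑[ y ← allFin m ] 𝟙 (Fin.suc y == Fin.zero))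
      ≡⟨ cong (1# +_) (trans (∑-cong (allFin m) λ y → cong 𝟙 (≢⇒== {x = Fin.suc y} {y = Fin.zero} λ ()))
                             (∑-zero (allFin m))) ⟩
    1# + 0#
      ≡⟨ +-identityʳ 1# ⟩
    1# ∎
  ∑-𝟙-== {suc m} (Fin.suc c) = begin
    𝟙 (Fin.zero == Fin.suc c) + ∑ (tabulate (Fin.suc {m})) (λ y → 𝟙 (y == Fin.suc c))
      ≡⟨ cong₂ _+_ (cong 𝟙 (≢⇒== {x = Fin.zero} {y = Fin.suc c} λ ()))
                   (∑-tabulate {m} Fin.suc λ y → 𝟙 (y == Fin.suc c)) ⟩
    0# + (∑[ y ← allFin m ] 𝟙 (Fin.suc y == Fin.suc c))
      ≡⟨ trans (+-identityˡ _) (∑-cong (allFin m) λ y → cong 𝟙 (true⇔⇒≡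
           (≡⇒== ∘ FinP.suc-injective ∘ ==⇒≡) (≡⇒== ∘ cong Fin.suc ∘ ==⇒≡))) ⟩
    ∑[ y ← allFin m ] 𝟙 (y == c)
      ≡⟨ ∑-𝟙-== c ⟩
    1# ∎

  agreeᵇ : ∀ {m k} → (Fin m → Fin k) → (Fin m → Fin k) → Bool
  agreeᵇ {m} f g = all (λ x → f x == g x) (allFin m)

  agreeᵇ-suc : ∀ {m k} (g π : Fin (suc m) → Fin k) →
               agreeᵇ g π ≡ (g Fin.zero == π Fin.zero) ∧ agreeᵇ (g ∘ Fin.suc) (π ∘ Fin.suc)
  agreeᵇ-suc {m} g π = cong (λ bs → (g Fin.zero == π Fin.zero) ∧ foldr _∧_ true bs)
    (trans (map-tabulate Fin.suc (λ x → g x == π x))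
           (sym (map-tabulate id (λ x → g (Fin.suc x) == π (Fin.suc x)))))

  ∑-𝟙-agreeᵇ : ∀ m {k} (π : Fin m → Fin k) → ∑[ f ← allFuns m k ] 𝟙 (agreeᵇ f π) ≡ 1#
  ∑-𝟙-agreeᵇ zero    π = +-identityʳ 1#
  ∑-𝟙-agreeᵇ (suc m) {k} π = begin
    ∑[ f ← allFuns (suc m) k ] 𝟙 (agreeᵇ f π)
      ≡⟨ ∑-concatMap (allFuns m k) _ _ ⟩
    _ ≡⟨ ∑-cong (allFuns m k) (λ f → trans (∑-map (allFin k) _ _) (∑-cong (allFin k) λ y →
           trans (cong 𝟙 (agreeᵇ-suc _ π)) (𝟙-∧ (y == π Fin.zero) _))) ⟩
    ∑[ f ← allFuns m k ] ∑[ y ← allFin k ] (𝟙 (y == π Fin.zero) * 𝟙 (agreeᵇ f (π ∘ Fin.suc)))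
      ≡⟨ ∑-cong (allFuns m k) (λ f → ∑-distribʳ (allFin k) _ _) ⟩
    ∑[ f ← allFuns m k ] ((∑[ y ← allFin k ] 𝟙 (y == π Fin.zero)) * 𝟙 (agreeᵇ f (π ∘ Fin.suc)))
      ≡⟨ ∑-cong (allFuns m k) (λ f → trans (cong (_* _) (∑-𝟙-== (π Fin.zero))) (*-identityˡ _)) ⟩
    ∑[ f ← allFuns m k ] 𝟙 (agreeᵇ f (π ∘ Fin.suc))
      ≡⟨ ∑-𝟙-agreeᵇ m (π ∘ Fin.suc) ⟩
    1# ∎

  module Reindex {X : Set} (_≈ᵇ_ : X → X → Bool) (L : List X)
                 (once : ∀ a → ∑[ x ← L ] 𝟙 (x ≈ᵇ a) ≡ 1#) where

    ∑-reindex : (f : X → A) → (∀ {a c} → (a ≈ᵇ c) ≡ true → f a ≡ f c) →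
                (φ ψ : X → X) → (∀ a x → (a ≈ᵇ φ x) ≡ (x ≈ᵇ ψ a)) →
                ∑[ x ← L ] f (φ x) ≡ ∑ L f
    ∑-reindex f f-resp φ ψ φψ = begin
      ∑[ x ← L ] f (φ x)                          ≡⟨ sym (∑-cong L λ x → collapse (φ x)) ⟩
      ∑[ x ← L ] ∑[ a ← L ] (𝟙 (a ≈ᵇ φ x) * f a)  ≡⟨ ∑-comm L L _ ⟩
      ∑[ a ← L ] ∑[ x ← L ] (𝟙 (a ≈ᵇ φ x) * f a)  ≡⟨ ∑-cong L (λ a → ∑-distribʳ L (f a) _) ⟩
      ∑[ a ← L ] ((∑[ x ← L ] 𝟙 (a ≈ᵇ φ x)) * f a) ≡⟨ ∑-cong L (λ a → cong (_* f a)
                                                      (trans (∑-cong L (cong 𝟙 ∘ φψ a)) (once (ψ a)))) ⟩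
      ∑[ a ← L ] (1# * f a)                       ≡⟨ ∑-cong L (λ a → *-identityˡ (f a)) ⟩
      ∑ L f                                       ∎
      where
      collapse : ∀ c → ∑[ a ← L ] (𝟙 (a ≈ᵇ c) * f a) ≡ f c
      collapse c = begin
        ∑[ a ← L ] (𝟙 (a ≈ᵇ c) * f a) ≡⟨ ∑-cong L pick ⟩
        ∑[ a ← L ] (𝟙 (a ≈ᵇ c) * f c) ≡⟨ ∑-distribʳ L (f c) _ ⟩
        (∑[ a ← L ] 𝟙 (a ≈ᵇ c)) * f c ≡⟨ cong (_* f c) (once c) ⟩
        1# * f c                       ≡⟨ *-identityˡ _ ⟩
        f c                            ∎
        where
        pick : ∀ a → 𝟙 (a ≈ᵇ c) * f a ≡ 𝟙 (a ≈ᵇ c) * f c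
        pick a with a ≈ᵇ c in a≈c
        ... | true  = cong (1# *_) (f-resp a≈c)
        ... | false = trans (zeroˡ _) (sym (zeroˡ _))

-- The sign of a permutation

module ℕ∑ = ListSum ℕP.+-*-isCommutativeSemiring

module _ {n : ℕ} where
  open ℕ∑
  open Nat using (_+_; _*_)

  infix 4 _<ᶠ_
  _<ᶠ_ : Fin n → Fin n → Bool
  i <ᶠ j = toℕ i <ᵇ toℕ j

  private
    <ᵇ-irrefl : ∀ k → (k <ᵇ k) ≡ false
    <ᵇ-irrefl zero    = refl
    <ᵇ-irrefl (suc k) = <ᵇ-irrefl k

    <ᵇ-asym : ∀ k l → ((k <ᵇ l) ∧ (l <ᵇ k)) ≡ false
    <ᵇ-asym zero    zero    = refl
    <ᵇ-asym zero    (suc l) = refl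
    <ᵇ-asym (suc k) zero    = refl
    <ᵇ-asym (suc k) (suc l) = <ᵇ-asym k l

    <ᵇ-flip : ∀ k l → k ≢ l → (l <ᵇ k) ≡ not (k <ᵇ l)
    <ᵇ-flip zero    zero    k≢l = ⊥-elim (k≢l refl)
    <ᵇ-flip zero    (suc l) _   = refl
    <ᵇ-flip (suc k) zero    _   = refl
    <ᵇ-flip (suc k) (suc l) k≢l = <ᵇ-flip k l (k≢l ∘ cong suc)

  <ᶠ-irrefl : ∀ i → (i <ᶠ i) ≡ false
  <ᶠ-irrefl i = <ᵇ-irrefl (toℕ i)

  <ᶠ-asym : ∀ i j → ((i <ᶠ j) ∧ (j <ᶠ i)) ≡ false
  <ᶠ-asym i j = <ᵇ-asym (toℕ i) (toℕ j)

  <ᶠ-flip : ∀ {i j} → i ≢ j → (j <ᶠ i) ≡ not (i <ᶠ j)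
  <ᶠ-flip {i} {j} i≢j = <ᵇ-flip (toℕ i) (toℕ j) (i≢j ∘ FinP.toℕ-injective)

  inversionSum : Perm n → ℕ
  inversionSum σ = ∑[ i ← allFin n ] ∑[ j ← allFin n ] (𝟙 (i <ᶠ j) * 𝟙 (σ j <ᶠ σ i))

  inversions≡inversionSum : ∀ σ → inversions σ ≡ inversionSum σ
  inversions≡inversionSum σ = begin
    length (concatMap row (allFin n))             ≡⟨ length≡∑1 (concatMap row (allFin n)) ⟩
    ∑[ _ ← concatMap row (allFin n) ] 1           ≡⟨ ∑-concatMap (allFin n) row _ ⟩
    ∑[ i ← allFin n ] ∑[ _ ← row i ] 1            ≡⟨ ∑-cong (allFin n) (λ i → ∑-filterᵇ (allFin n) (p i) _) ⟩
    ∑[ i ← allFin n ] ∑[ j ← allFin n ] (𝟙 (p i j) * 1)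
      ≡⟨ ∑-cong (allFin n) (λ i → ∑-cong (allFin n) λ j →
           trans (ℕP.*-identityʳ _) (𝟙-∧ (i <ᶠ j) (σ j <ᶠ σ i))) ⟩
    inversionSum σ                                ∎
    where
    p : Fin n → Fin n → Bool
    p i j = (i <ᶠ j) ∧ (σ j <ᶠ σ i)
    row : Fin n → List (Fin n)
    row i = filterᵇ (p i) (allFin n)
    length≡∑1 : ∀ {X : Set} (xs : List X) → length xs ≡ ∑[ _ ← xs ] 1
    length≡∑1 []       = refl
    length≡∑1 (x ∷ xs) = cong suc (length≡∑1 xs)

  inversionSum-cong : ∀ {σ τ} → σ ≗ τ → inversionSum σ ≡ inversionSum τ
  inversionSum-cong σ≗τ = ∑-cong (allFin n) λ i → ∑-cong (allFin n) λ j →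
    cong₂ (λ u v → 𝟙 (i <ᶠ j) * 𝟙 (u <ᶠ v)) (σ≗τ j) (σ≗τ i)

  ∑-permute : (τ τ′ : Perm n) → τ ∘ τ′ ≗ id → τ′ ∘ τ ≗ id →
              ∀ F → ∑[ x ← allFin n ] F (τ x) ≡ ∑ (allFin n) F
  ∑-permute τ τ′ τ∘τ′ τ′∘τ F = ∑-reindex F (cong F ∘ ==⇒≡) τ τ′ λ a x → true⇔⇒≡
    (λ a≡τx → ≡⇒== (trans (sym (τ′∘τ x)) (cong τ′ (sym (==⇒≡ a≡τx)))))
    (λ x≡τ′a → ≡⇒== (trans (sym (τ∘τ′ a)) (cong τ (sym (==⇒≡ x≡τ′a)))))
    where open Reindex _==_ (allFin n) ∑-𝟙-==

  inversionSum-id : inversionSum id ≡ 0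
  inversionSum-id = trans (∑-cong (allFin n) λ i →
      trans (∑-cong (allFin n) λ j → trans (sym (𝟙-∧ (i <ᶠ j) (j <ᶠ i))) (cong 𝟙 (<ᶠ-asym i j)))
            (∑-zero (allFin n)))
    (∑-zero (allFin n))

  -- Modulo 2, inversionSum σ + inversionSum (σ ∘ τ) only counts the pairs on which the orders
  -- _<ᶠ_ and _<ᶠ_ on τ′-images disagree; for injective σ each unordered such pair contributes
  -- exactly once, whatever σ is.
  module _ (τ τ′ : Perm n) (τ∘τ′ : τ ∘ τ′ ≗ id) (τ′∘τ : τ′ ∘ τ ≗ id) where

    private
      weighted : (Fin n → Fin n → Bool) → Perm n → ℕ
      weighted e σ = ∑[ i ← allFin n ] ∑[ j ← allFin n ] (𝟙 (e i j) * 𝟙 (σ j <ᶠ σ i))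

      disagree agree : Fin n → Fin n → Bool
      disagree i j = (i <ᶠ j) xor (τ′ i <ᶠ τ′ j)
      agree    i j = (i <ᶠ j) ∧ (τ′ i <ᶠ τ′ j)

      τ′-injective : Injective _≡_ _≡_ τ′
      τ′-injective {x} {y} e = trans (sym (τ∘τ′ x)) (trans (cong τ e) (τ∘τ′ y))

      inversionSum-∘ : ∀ σ → inversionSum (σ ∘ τ) ≡ weighted (λ i j → τ′ i <ᶠ τ′ j) σ
      inversionSum-∘ σ = begin
        inversionSum (σ ∘ τ)
          ≡⟨ ∑-cong (allFin n) (λ i → ∑-cong (allFin n) λ j →
               sym (cong₂ (λ u v → 𝟙 (u <ᶠ v) * 𝟙 (σ (τ j) <ᶠ σ (τ i))) (τ′∘τ i) (τ′∘τ j))) ⟩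
        ∑[ i ← allFin n ] ∑[ j ← allFin n ] G (τ i) (τ j)
          ≡⟨ ∑-cong (allFin n) (λ i → ∑-permute τ τ′ τ∘τ′ τ′∘τ (G (τ i))) ⟩
        ∑[ i ← allFin n ] ∑[ j ← allFin n ] G (τ i) j
          ≡⟨ ∑-permute τ τ′ τ∘τ′ τ′∘τ (λ i → ∑[ j ← allFin n ] G i j) ⟩
        weighted (λ i j → τ′ i <ᶠ τ′ j) σ ∎
        where
        G : Fin n → Fin n → ℕ
        G i j = 𝟙 (τ′ i <ᶠ τ′ j) * 𝟙 (σ j <ᶠ σ i)

      𝟙-+ : ∀ a b → 𝟙 a + 𝟙 b ≡ 𝟙 (a xor b) + 2 * 𝟙 (a ∧ b)
      𝟙-+ true  true  = refl
      𝟙-+ true  false = refl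
      𝟙-+ false true  = refl
      𝟙-+ false false = refl

      split : ∀ σ → inversionSum σ + inversionSum (σ ∘ τ) ≡ weighted disagree σ + 2 * weighted agree σ
      split σ = begin
        inversionSum σ + inversionSum (σ ∘ τ)
          ≡⟨ cong (inversionSum σ +_) (inversionSum-∘ σ) ⟩
        weighted _<ᶠ_ σ + weighted (λ i j → τ′ i <ᶠ τ′ j) σ
          ≡⟨ sym (∑∑-distrib-+ (allFin n) (allFin n) _ _) ⟩
        ∑[ i ← allFin n ] ∑[ j ← allFin n ] (𝟙 (i <ᶠ j) * s i j + 𝟙 (τ′ i <ᶠ τ′ j) * s i j)
          ≡⟨ ∑-cong (allFin n) (λ i → ∑-cong (allFin n) λ j → termwise i j) ⟩
        ∑[ i ← allFin n ] ∑[ j ← allFin n ] (𝟙 (disagree i j) * s i j + 2 * (𝟙 (agree i j) * s i j))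
          ≡⟨ ∑∑-distrib-+ (allFin n) (allFin n) _ _ ⟩
        weighted disagree σ + (∑[ i ← allFin n ] ∑[ j ← allFin n ] (2 * (𝟙 (agree i j) * s i j)))
          ≡⟨ cong (weighted disagree σ +_)
               (trans (∑-cong (allFin n) λ i → ∑-distribˡ (allFin n) 2 _) (∑-distribˡ (allFin n) 2 _)) ⟩
        weighted disagree σ + 2 * weighted agree σ ∎
        where
        s : Fin n → Fin n → ℕ
        s i j = 𝟙 (σ j <ᶠ σ i)
        termwise : ∀ i j → 𝟙 (i <ᶠ j) * s i j + 𝟙 (τ′ i <ᶠ τ′ j) * s i j
                         ≡ 𝟙 (disagree i j) * s i j + 2 * (𝟙 (agree i j) * s i j)
        termwise i j = begin
          𝟙 (i <ᶠ j) * s i j + 𝟙 (τ′ i <ᶠ τ′ j) * s i j   ≡⟨ sym (ℕP.*-distribʳ-+ (s i j) (𝟙 (i <ᶠ j)) _) ⟩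
          (𝟙 (i <ᶠ j) + 𝟙 (τ′ i <ᶠ τ′ j)) * s i j         ≡⟨ cong (_* s i j) (𝟙-+ (i <ᶠ j) _) ⟩
          (𝟙 (disagree i j) + 2 * 𝟙 (agree i j)) * s i j  ≡⟨ ℕP.*-distribʳ-+ (s i j) (𝟙 (disagree i j)) _ ⟩
          _                                              ≡⟨ cong (𝟙 (disagree i j) * s i j +_)
                                                              (ℕP.*-assoc 2 (𝟙 (agree i j)) (s i j)) ⟩
          𝟙 (disagree i j) * s i j + 2 * (𝟙 (agree i j) * s i j) ∎

      disagree-sym : ∀ i j → disagree j i ≡ disagree i j
      disagree-sym i j with i ≟ j
      ... | yes refl = refl
      ... | no i≢j rewrite <ᶠ-flip i≢j | <ᶠ-flip (i≢j ∘ τ′-injective)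
        with i <ᶠ j | τ′ i <ᶠ τ′ j
      ...   | true  | true  = refl
      ...   | true  | false = refl
      ...   | false | true  = refl
      ...   | false | false = refl

      weighted-disagree-double : ∀ {σ} → Injective _≡_ _≡_ σ →
        weighted disagree σ + weighted disagree σ ≡ ∑[ i ← allFin n ] ∑[ j ← allFin n ] 𝟙 (disagree i j)
      weighted-disagree-double {σ} σ-inj = begin
        weighted disagree σ + weighted disagree σ
          ≡⟨ cong (weighted disagree σ +_) (∑-comm (allFin n) (allFin n) _) ⟩
        weighted disagree σ + (∑[ i ← allFin n ] ∑[ j ← allFin n ] (𝟙 (disagree j i) * 𝟙 (σ i <ᶠ σ j)))
          ≡⟨ cong (weighted disagree σ +_) (∑-cong (allFin n) λ i → ∑-cong (allFin n) λ j →
               cong (λ b → 𝟙 b * 𝟙 (σ i <ᶠ σ j)) (disagree-sym i j)) ⟩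
        weighted disagree σ + (∑[ i ← allFin n ] ∑[ j ← allFin n ] (𝟙 (disagree i j) * 𝟙 (σ i <ᶠ σ j)))
          ≡⟨ sym (∑∑-distrib-+ (allFin n) (allFin n) _ _) ⟩
        ∑[ i ← allFin n ] ∑[ j ← allFin n ]
          (𝟙 (disagree i j) * 𝟙 (σ j <ᶠ σ i) + 𝟙 (disagree i j) * 𝟙 (σ i <ᶠ σ j))
          ≡⟨ ∑-cong (allFin n) (λ i → ∑-cong (allFin n) λ j → termwise i j) ⟩
        ∑[ i ← allFin n ] ∑[ j ← allFin n ] 𝟙 (disagree i j) ∎
        where
        termwise : ∀ i j → 𝟙 (disagree i j) * 𝟙 (σ j <ᶠ σ i) + 𝟙 (disagree i j) * 𝟙 (σ i <ᶠ σ j)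
                         ≡ 𝟙 (disagree i j)
        termwise i j with i ≟ j
        ... | yes refl rewrite <ᶠ-irrefl i | <ᶠ-irrefl (τ′ i) = refl
        ... | no i≢j = begin
          𝟙 (disagree i j) * 𝟙 (σ j <ᶠ σ i) + 𝟙 (disagree i j) * 𝟙 (σ i <ᶠ σ j)
            ≡⟨ sym (ℕP.*-distribˡ-+ (𝟙 (disagree i j)) _ _) ⟩
          𝟙 (disagree i j) * (𝟙 (σ j <ᶠ σ i) + 𝟙 (σ i <ᶠ σ j))
            ≡⟨ cong (λ b → 𝟙 (disagree i j) * (𝟙 b + 𝟙 (σ i <ᶠ σ j))) (<ᶠ-flip (i≢j ∘ σ-inj)) ⟩
          𝟙 (disagree i j) * (𝟙 (not (σ i <ᶠ σ j)) + 𝟙 (σ i <ᶠ σ j))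
            ≡⟨ cong (𝟙 (disagree i j) *_) (𝟙-not+ (σ i <ᶠ σ j)) ⟩
          𝟙 (disagree i j) * 1 ≡⟨ ℕP.*-identityʳ _ ⟩
          𝟙 (disagree i j) ∎
          where
          𝟙-not+ : ∀ b → 𝟙 (not b) + 𝟙 b ≡ 1
          𝟙-not+ true  = refl
          𝟙-not+ false = refl

      weighted-disagree-invariant : ∀ {σ} → Injective _≡_ _≡_ σ → weighted disagree σ ≡ weighted disagree id
      weighted-disagree-invariant {σ} σ-inj = ℕP.*-cancelˡ-≡ _ _ 2 (begin
        2 * weighted disagree σ                     ≡⟨ cong (weighted disagree σ +_) (ℕP.+-identityʳ _) ⟩
        weighted disagree σ + weighted disagree σ   ≡⟨ weighted-disagree-double σ-inj ⟩
        ∑[ i ← allFin n ] ∑[ j ← allFin n ] 𝟙 (disagree i j) ≡⟨ sym (weighted-disagree-double id) ⟩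
        weighted disagree id + weighted disagree id ≡⟨ cong (weighted disagree id +_) (sym (ℕP.+-identityʳ _)) ⟩
        2 * weighted disagree id ∎)

      parity-+-double : ∀ a b → parity (a + 2 * b) ≡ parity a
      parity-+-double a b = trans (ℙP.+-homo-+ a (2 * b))
        (trans (cong (parity a ℙ.+_) (ℙP.*-homo-* 2 b)) (ℙP.+-identityʳ (parity a)))

    parity-inversionSum-∘ : ∀ {σ} → Injective _≡_ _≡_ σ →
      parity (inversionSum (σ ∘ τ)) ≡ parity (inversionSum σ) ℙ.+ parity (inversionSum τ)
    parity-inversionSum-∘ {σ} σ-inj = ℙP.+-cancelˡ-≡ p _ _ (begin
      p ℙ.+ parity (inversionSum (σ ∘ τ))         ≡⟨ sym (ℙP.+-homo-+ (inversionSum σ) _) ⟩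
      parity (inversionSum σ + inversionSum (σ ∘ τ)) ≡⟨ cong parity (split σ) ⟩
      parity (weighted disagree σ + 2 * weighted agree σ)   ≡⟨ parity-+-double (weighted disagree σ) (weighted agree σ) ⟩
      parity (weighted disagree σ)                ≡⟨ cong parity (weighted-disagree-invariant σ-inj) ⟩
      parity (weighted disagree id)               ≡⟨ sym (parity-+-double (weighted disagree id) (weighted agree id)) ⟩
      parity (weighted disagree id + 2 * weighted agree id) ≡⟨ cong parity (sym (split id)) ⟩
      parity (inversionSum id + inversionSum τ)   ≡⟨ cong (λ k → parity (k + inversionSum τ)) inversionSum-id ⟩
      parity (inversionSum τ)                     ≡⟨ sym (cancel p (parity (inversionSum τ))) ⟩
      p ℙ.+ (p ℙ.+ parity (inversionSum τ))       ∎)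
      where
      p = parity (inversionSum σ)
      cancel : ∀ q r → q ℙ.+ (q ℙ.+ r) ≡ r
      cancel q r = trans (sym (ℙP.+-assoc q q r)) (cong (ℙ._+ r) (ℙP.p+p≡0ℙ q))

inversionSum-swap₀₁ : ∀ m → inversionSum (swap {suc (suc m)} Fin.zero (Fin.suc Fin.zero)) ≡ 1
inversionSum-swap₀₁ m = cong₂ Nat._+_ row₀ (cong₂ Nat._+_ row₁ rows₂₊)
  where
  open ℕ∑
  s = swap {suc (suc m)} Fin.zero (Fin.suc Fin.zero)
  skip2 : Fin m → Fin (suc (suc m))
  skip2 k = Fin.suc (Fin.suc k)
  row : Fin (suc (suc m)) → ℕ
  row i = ∑[ j ← allFin (suc (suc m)) ] (𝟙 (i <ᶠ j) Nat.* 𝟙 (s j <ᶠ s i))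
  row₀ : row Fin.zero ≡ 1
  row₀ = cong (λ u → 0 Nat.+ (1 Nat.+ u)) (trans (∑-tabulate {m} skip2 _) (∑-zero (allFin m)))
  row₁ : row (Fin.suc Fin.zero) ≡ 0
  row₁ = trans (∑-tabulate {m} skip2 _) (∑-zero (allFin m))
  rows₂₊ : ∑ (tabulate skip2) row ≡ 0
  rows₂₊ = trans (∑-tabulate {m} skip2 row) (trans (∑-cong (allFin m) (λ k →
    trans (∑-tabulate {m} skip2 _) (trans (∑-cong (allFin m) (λ l →
      trans (sym (𝟙-∧ (skip2 k <ᶠ skip2 l) (skip2 l <ᶠ skip2 k))) (cong 𝟙 (<ᶠ-asym (skip2 k) (skip2 l)))))
      (∑-zero (allFin m))))) (∑-zero (allFin m)))

module _ {n : ℕ} where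

  injective⇒surjective : ∀ {σ : Perm n} → Injective _≡_ _≡_ σ → ∀ y → ∃ λ x → σ x ≡ y
  injective⇒surjective {σ} σ-inj y with FinP.any? (λ x → σ x ≟ y)
  ... | yes hit = hit
  ... | no miss = ⊥-elim (pigeonhole n refl y)
    where
    pigeonhole : ∀ m → m ≡ n → Fin m → ⊥
    pigeonhole (suc m) refl _ =
      ℕP.<-irrefl refl (FinP.injective⇒≤ {f = squeeze} λ {a} {b} e →
        σ-inj (FinP.punchOut-injective {i = y} (avoid a) (avoid b) e))
      where
      avoid : ∀ x → y ≢ σ x
      avoid x y≡σx = miss (x , sym y≡σx)
      squeeze : Fin (suc m) → Fin m
      squeeze x = Fin.punchOut (avoid x)

-- swap a b is conjugate to swap 0 1 by ρ = swap 0 a ∘ swap 1 (swap 0 a b).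
parity-inversionSum-swap : ∀ {n} {a b : Fin n} → a ≢ b → parity (inversionSum (swap a b)) ≡ 1ℙ
parity-inversionSum-swap {suc zero} {Fin.zero} {Fin.zero} a≢b = ⊥-elim (a≢b refl)
parity-inversionSum-swap {suc (suc m)} {a} {b} a≢b = ℙP.+-cancelʳ-≡ (parity (inversionSum ρ)) _ _ (begin
  parity (inversionSum (swap a b)) ℙ.+ parity (inversionSum ρ)
    ≡⟨ sym (parity-inversionSum-∘ ρ ρ′ ρ∘ρ′ ρ′∘ρ (swap-injective a b)) ⟩
  parity (inversionSum (swap a b ∘ ρ))
    ≡⟨ cong parity (inversionSum-cong λ x →
         sym (trans (swap-conjugate ρ-inj z o x) (cong₂ (λ u v → swap u v (ρ x)) ρz≡a ρo≡b))) ⟩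
  parity (inversionSum (ρ ∘ swap z o))
    ≡⟨ parity-inversionSum-∘ (swap z o) (swap z o) (swap-involutive z o) (swap-involutive z o) ρ-inj ⟩
  parity (inversionSum ρ) ℙ.+ parity (inversionSum (swap z o))
    ≡⟨ cong (λ k → parity (inversionSum ρ) ℙ.+ parity k) (inversionSum-swap₀₁ m) ⟩
  parity (inversionSum ρ) ℙ.+ 1ℙ
    ≡⟨ ℙP.+-comm (parity (inversionSum ρ)) 1ℙ ⟩
  1ℙ ℙ.+ parity (inversionSum ρ) ∎)
  where
  z o b′ : Fin (suc (suc m))
  z  = Fin.zero
  o  = Fin.suc Fin.zero
  b′ = swap z a b
  ρ ρ′ : Perm (suc (suc m))
  ρ  = swap z a ∘ swap o b′
  ρ′ = swap o b′ ∘ swap z a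
  ρ∘ρ′ : ρ ∘ ρ′ ≗ id
  ρ∘ρ′ x = trans (cong (swap z a) (swap-involutive o b′ (swap z a x))) (swap-involutive z a x)
  ρ′∘ρ : ρ′ ∘ ρ ≗ id
  ρ′∘ρ x = trans (cong (swap o b′) (swap-involutive z a (swap o b′ x))) (swap-involutive o b′ x)
  ρ-inj : Injective _≡_ _≡_ ρ
  ρ-inj = swap-injective o b′ ∘ swap-injective z a
  z≢b′ : z ≢ b′
  z≢b′ z≡b′ = a≢b (trans (sym (swap-β₁ z a)) (trans (cong (swap z a) z≡b′) (swap-involutive z a b)))
  ρz≡a : ρ z ≡ a
  ρz≡a = trans (cong (swap z a) (swap-fixes o b′ z (λ ()) z≢b′)) (swap-β₁ z a)
  ρo≡b : ρ o ≡ b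
  ρo≡b = trans (cong (swap z a) (swap-β₁ o b′)) (swap-involutive z a b)

signℚ : Parity → ℚ
signℚ 0ℙ = 1ℚ
signℚ 1ℙ = ℚ.- 1ℚ

sgn≡signℚ-parity : ∀ {n} (σ : Perm n) → sgn σ ≡ signℚ (parity (inversionSum σ))
sgn≡signℚ-parity σ = trans (cong (λ k → if (k % 2) ≡ᵇ 0 then 1ℚ else ℚ.- 1ℚ) (inversions≡inversionSum σ))
                           (byParity (inversionSum σ))
  where
  byParity : ∀ k → (if (k % 2) ≡ᵇ 0 then 1ℚ else ℚ.- 1ℚ) ≡ signℚ (parity k)
  byParity zero          = refl
  byParity (suc zero)    = refl
  byParity (suc (suc k)) = trans (cong (λ r → if r ≡ᵇ 0 then 1ℚ else ℚ.- 1ℚ)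
    (trans (cong (_% 2) (ℕP.+-comm 2 k)) (ℕDM.[m+n]%n≡m%n k 2))) (byParity k)

module _ {n : ℕ} where

  sgn-cong : ∀ {σ τ : Perm n} → σ ≗ τ → sgn σ ≡ sgn τ
  sgn-cong {σ} {τ} σ≗τ = trans (sgn≡signℚ-parity σ)
    (trans (cong (signℚ ∘ parity) (inversionSum-cong σ≗τ)) (sym (sgn≡signℚ-parity τ)))

  sgn-∘-swap : ∀ {σ : Perm n} → Injective _≡_ _≡_ σ → ∀ {a b} → a ≢ b → sgn (σ ∘ swap a b) ≡ ℚ.- sgn σ
  sgn-∘-swap {σ} σ-inj {a} {b} a≢b = begin
    sgn (σ ∘ swap a b)
      ≡⟨ sgn≡signℚ-parity (σ ∘ swap a b) ⟩
    signℚ (parity (inversionSum (σ ∘ swap a b)))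
      ≡⟨ cong signℚ (parity-inversionSum-∘ (swap a b) (swap a b) (swap-involutive a b) (swap-involutive a b) σ-inj) ⟩
    signℚ (parity (inversionSum σ) ℙ.+ parity (inversionSum (swap a b)))
      ≡⟨ cong (λ p → signℚ (parity (inversionSum σ) ℙ.+ p)) (parity-inversionSum-swap a≢b) ⟩
    signℚ (parity (inversionSum σ) ℙ.+ 1ℙ)
      ≡⟨ signℚ-+1ℙ (parity (inversionSum σ)) ⟩
    ℚ.- signℚ (parity (inversionSum σ))
      ≡⟨ cong ℚ.-_ (sym (sgn≡signℚ-parity σ)) ⟩
    ℚ.- sgn σ ∎
    where
    signℚ-+1ℙ : ∀ p → signℚ (p ℙ.+ 1ℙ) ≡ ℚ.- signℚ p
    signℚ-+1ℙ 0ℙ = refl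
    signℚ-+1ℙ 1ℙ = refl

  sgn-swap-∘ : ∀ {σ : Perm n} → Injective _≡_ _≡_ σ → ∀ {t y} → t ≢ y → sgn (swap t y ∘ σ) ≡ ℚ.- sgn σ
  sgn-swap-∘ {σ} σ-inj {t} {y} t≢y
    with injective⇒surjective σ-inj t | injective⇒surjective σ-inj y
  ... | a , σa≡t | b , σb≡y = trans (sgn-cong conj) (sgn-∘-swap σ-inj (t≢y ∘ a≡b⇒t≡y))
    where
    conj : swap t y ∘ σ ≗ σ ∘ swap a b
    conj x = sym (trans (swap-conjugate σ-inj a b x) (cong₂ (λ u v → swap u v (σ x)) σa≡t σb≡y))
    a≡b⇒t≡y : a ≡ b → t ≡ y
    a≡b⇒t≡y a≡b = trans (sym σa≡t) (trans (cong σ a≡b) σb≡y)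

-- The group algebra, up to pointwise equality of permutations

module ℚ∑ = ListSum (IsCommutativeRing.isCommutativeSemiring ℚP.+-*-isCommutativeRing)

module _ {n : ℕ} where
  open ℚ∑
  open import Data.Rational using (_+_; _*_; -_)
  open import Algebra.Properties.CommutativeSemigroup
    (CommutativeRing.*-commutativeSemigroup ℚP.+-*-commutativeRing) using (x∙yz≈y∙xz)
  open import Algebra.Properties.Ring (CommutativeRing.ring ℚP.+-*-commutativeRing) using (-1*x≈-x)

  Extensional : (Perm n → ℚ) → Set
  Extensional h = ∀ {σ τ} → σ ≗ τ → h σ ≡ h τ

  ⟦_⟧ : QS n → (Perm n → ℚ) → ℚ
  ⟦ x ⟧ h = ∑[ t ← x ] (proj₁ t * h (proj₂ t))

  -- Elements of QS n pair raw functions with coefficients, so the algebra laws hold only up to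
  -- pointwise equality of the functions: x ∼ y says that x and y agree as linear functionals on
  -- all test functions that respect pointwise equality.  Testing against the indicator of a
  -- single permutation recovers _≈_ (∼⇒≈).
  infix 4 _∼_
  record _∼_ (x y : QS n) : Set where
    constructor mk∼
    field run : ∀ h → Extensional h → ⟦ x ⟧ h ≡ ⟦ y ⟧ h
  open _∼_

  ∼-refl : ∀ {x} → x ∼ x
  ∼-refl = mk∼ λ _ _ → refl

  ∼-sym : ∀ {x y} → x ∼ y → y ∼ x
  ∼-sym x∼y = mk∼ λ h h-ext → sym (run x∼y h h-ext)

  ∼-trans : ∀ {x y z} → x ∼ y → y ∼ z → x ∼ z
  ∼-trans x∼y y∼z = mk∼ λ h h-ext → trans (run x∼y h h-ext) (run y∼z h h-ext)

  ∼-setoid : Setoid 0ℓ 0ℓ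
  ∼-setoid = record
    { Carrier = QS n ; _≈_ = _∼_
    ; isEquivalence = record { refl = ∼-refl ; sym = ∼-sym ; trans = ∼-trans } }

  open SetoidReasoning ∼-setoid using (step-≈-⟩) renaming (begin_ to begin∼_; _∎ to _∎∼)

  ⌜_⌝ : Perm n → QS n
  ⌜ σ ⌝ = (1ℚ , σ) ∷ []

  ⟦⟧-cong : ∀ (x : QS n) {h h′} → h ≗ h′ → ⟦ x ⟧ h ≡ ⟦ x ⟧ h′
  ⟦⟧-cong x h≗h′ = ∑-cong x λ t → cong (proj₁ t *_) (h≗h′ (proj₂ t))

  ⟦⌜⌝⟧ : ∀ σ h → ⟦ ⌜ σ ⌝ ⟧ h ≡ h σ
  ⟦⌜⌝⟧ σ h = trans (ℚP.+-identityʳ _) (ℚP.*-identityˡ (h σ))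

  ⟦++⟧ : ∀ (x y : QS n) h → ⟦ x ++ y ⟧ h ≡ ⟦ x ⟧ h + ⟦ y ⟧ h
  ⟦++⟧ x y h = ∑-++ x y _

  ⟦scale⟧ : ∀ c (x : QS n) h → ⟦ scale c x ⟧ h ≡ c * ⟦ x ⟧ h
  ⟦scale⟧ c x h =
    trans (∑-map x _ _) (trans (∑-cong x λ t → ℚP.*-assoc c (proj₁ t) _) (∑-distribˡ x c _))

  ⟦·⟧ : ∀ (x y : QS n) h → ⟦ x · y ⟧ h ≡ ⟦ x ⟧ (λ σ → ⟦ y ⟧ (λ τ → h (σ ∘ τ)))
  ⟦·⟧ x y h = trans (∑-concatMap x _ _) (∑-cong x λ s →
    trans (∑-map y _ _) (trans (∑-cong y λ t → ℚP.*-assoc (proj₁ s) (proj₁ t) _)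
                               (∑-distribˡ y (proj₁ s) _)))

  ⟦⟧-comm : ∀ (x y : QS n) (k : Perm n → Perm n → ℚ) →
            ⟦ x ⟧ (λ σ → ⟦ y ⟧ (k σ)) ≡ ⟦ y ⟧ (λ τ → ⟦ x ⟧ (λ σ → k σ τ))
  ⟦⟧-comm x y k = begin
    ∑[ s ← x ] (proj₁ s * ∑[ t ← y ] (proj₁ t * k (proj₂ s) (proj₂ t)))
      ≡⟨ ∑-cong x (λ s → sym (∑-distribˡ y (proj₁ s) _)) ⟩
    ∑[ s ← x ] ∑[ t ← y ] (proj₁ s * (proj₁ t * k (proj₂ s) (proj₂ t)))
      ≡⟨ ∑-cong x (λ s → ∑-cong y λ t → x∙yz≈y∙xz (proj₁ s) (proj₁ t) _) ⟩
    ∑[ s ← x ] ∑[ t ← y ] (proj₁ t * (proj₁ s * k (proj₂ s) (proj₂ t)))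
      ≡⟨ ∑-comm x y _ ⟩
    ∑[ t ← y ] ∑[ s ← x ] (proj₁ t * (proj₁ s * k (proj₂ s) (proj₂ t)))
      ≡⟨ ∑-cong y (λ t → ∑-distribˡ x (proj₁ t) _) ⟩
    ∑[ t ← y ] (proj₁ t * ∑[ s ← x ] (proj₁ s * k (proj₂ s) (proj₂ t))) ∎

  ∑-neg : ∀ {X : Set} (xs : List X) f → ∑[ x ← xs ] (- f x) ≡ - ∑ xs f
  ∑-neg []       f = refl
  ∑-neg (x ∷ xs) f = trans (cong (- f x +_) (∑-neg xs f)) (sym (ℚP.neg-distrib-+ (f x) (∑ xs f)))

  ⟦⟧-scale : ∀ (x : QS n) c g → ⟦ x ⟧ (λ σ → c * g σ) ≡ c * ⟦ x ⟧ g
  ⟦⟧-scale x c g = trans (∑-cong x λ t → x∙yz≈y∙xz (proj₁ t) c _) (∑-distribˡ x c _)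

  ∘ˡ-extensional : ∀ {h} → Extensional h → ∀ σ → Extensional (λ τ → h (σ ∘ τ))
  ∘ˡ-extensional h-ext σ τ≗τ′ = h-ext (cong σ ∘ τ≗τ′)

  ⟦⟧-extensional : ∀ (y : QS n) {h} → Extensional h → Extensional (λ σ → ⟦ y ⟧ (λ τ → h (σ ∘ τ)))
  ⟦⟧-extensional y h-ext σ≗σ′ = ⟦⟧-cong y λ τ → h-ext (σ≗σ′ ∘ τ)

  samePermᵇ⇒≗ : ∀ {σ τ : Perm n} → samePermᵇ σ τ ≡ true → σ ≗ τ
  samePermᵇ⇒≗ {σ} {τ} e x = ==⇒≡ (all≡true⇒ (λ x → σ x == τ x) (allFin n) e (∈-allFin x))

  ≗⇒samePermᵇ : ∀ {σ τ : Perm n} → σ ≗ τ → samePermᵇ σ τ ≡ true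
  ≗⇒samePermᵇ {σ} {τ} σ≗τ = all≡true⇐ (λ x → σ x == τ x) (allFin n) λ {x} _ → ≡⇒== (σ≗τ x)

  ∼⇒≈ : ∀ {x y : QS n} → x ∼ y → x ≈ y
  ∼⇒≈ {x} {y} x∼y π = trans (coeff≡⟦⟧ x) (trans (run x∼y χ χ-ext) (sym (coeff≡⟦⟧ y)))
    where
    χ : Perm n → ℚ
    χ σ = 𝟙 (samePermᵇ σ π)
    χ-ext : Extensional χ
    χ-ext σ≗τ = cong 𝟙 (true⇔⇒≡
      (λ e → ≗⇒samePermᵇ λ x → trans (sym (σ≗τ x)) (samePermᵇ⇒≗ e x))
      (λ e → ≗⇒samePermᵇ λ x → trans (σ≗τ x) (samePermᵇ⇒≗ e x)))
    coeff≡⟦⟧ : ∀ (x : QS n) → coeff x π ≡ ⟦ x ⟧ χ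
    coeff≡⟦⟧ x = trans (∑-filterᵇ x (λ t → samePermᵇ (proj₂ t) π) proj₁)
                       (∑-cong x λ t → ℚP.*-comm _ (proj₁ t))

  ∑-allPerms-reindex : ∀ (F : Perm n → ℚ) → Extensional F → (φ : Perm n → Perm n) →
                       (∀ {σ τ} → σ ≗ φ τ → τ ≗ φ σ) → ∑[ σ ← allFuns n n ] F (φ σ) ≡ ∑ (allFuns n n) F
  ∑-allPerms-reindex F F-ext φ φ-involutive = ∑-reindex F (F-ext ∘ samePermᵇ⇒≗) φ φ λ σ τ → true⇔⇒≡
    (≗⇒samePermᵇ ∘ φ-involutive ∘ samePermᵇ⇒≗) (≗⇒samePermᵇ ∘ φ-involutive ∘ samePermᵇ⇒≗)
    where open Reindex samePermᵇ (allFuns n n) (∑-𝟙-agreeᵇ n)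

  ∑-allPerms-swap∘ : ∀ (F : Perm n → ℚ) → Extensional F → ∀ a b →
                     ∑[ σ ← allFuns n n ] F (swap a b ∘ σ) ≡ ∑ (allFuns n n) F
  ∑-allPerms-swap∘ F F-ext a b = ∑-allPerms-reindex F F-ext (swap a b ∘_) λ {σ} {τ} σ≗sτ x →
    trans (sym (swap-involutive a b (τ x))) (cong (swap a b) (sym (σ≗sτ x)))

  ∑-allPerms-∘swap : ∀ (F : Perm n → ℚ) → Extensional F → ∀ a b →
                     ∑[ σ ← allFuns n n ] F (σ ∘ swap a b) ≡ ∑ (allFuns n n) F
  ∑-allPerms-∘swap F F-ext a b = ∑-allPerms-reindex F F-ext (_∘ swap a b) λ {σ} {τ} σ≗τs x →
    trans (cong τ (sym (swap-involutive a b x))) (sym (σ≗τs (swap a b x)))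

  ·-congˡ : ∀ {x x′} y → x ∼ x′ → x · y ∼ x′ · y
  ·-congˡ {x} {x′} y x∼x′ = mk∼ λ h h-ext →
    trans (⟦·⟧ x y h) (trans (run x∼x′ _ (⟦⟧-extensional y h-ext)) (sym (⟦·⟧ x′ y h)))

  ·-congʳ : ∀ x {y y′} → y ∼ y′ → x · y ∼ x · y′
  ·-congʳ x {y} {y′} y∼y′ = mk∼ λ h h-ext → trans (⟦·⟧ x y h)
    (trans (⟦⟧-cong x λ σ → run y∼y′ _ (∘ˡ-extensional h-ext σ)) (sym (⟦·⟧ x y′ h)))

  ·-assoc : ∀ x y z → (x · y) · z ∼ x · (y · z)
  ·-assoc x y z = mk∼ λ h _ → begin
    ⟦ (x · y) · z ⟧ h                                             ≡⟨ ⟦·⟧ (x · y) z h ⟩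
    ⟦ x · y ⟧ (λ ρ → ⟦ z ⟧ (λ υ → h (ρ ∘ υ)))                      ≡⟨ ⟦·⟧ x y _ ⟩
    ⟦ x ⟧ (λ σ → ⟦ y ⟧ (λ τ → ⟦ z ⟧ (λ υ → h (σ ∘ τ ∘ υ))))        ≡⟨ ⟦⟧-cong x (λ σ → sym (⟦·⟧ y z _)) ⟩
    ⟦ x ⟧ (λ σ → ⟦ y · z ⟧ (λ ρ → h (σ ∘ ρ)))                      ≡⟨ sym (⟦·⟧ x (y · z) h) ⟩
    ⟦ x · (y · z) ⟧ h                                             ∎

  ·-identityˡ : ∀ x → one · x ∼ x
  ·-identityˡ x = mk∼ λ h _ → trans (⟦·⟧ one x h) (⟦⌜⌝⟧ id λ σ → ⟦ x ⟧ (λ τ → h (σ ∘ τ)))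

  ⌜⌝-∘ : ∀ σ τ → ⌜ σ ⌝ · ⌜ τ ⌝ ∼ ⌜ σ ∘ τ ⌝
  ⌜⌝-∘ σ τ = mk∼ λ h _ → trans (⟦·⟧ ⌜ σ ⌝ ⌜ τ ⌝ h)
    (trans (⟦⌜⌝⟧ σ λ σ′ → ⟦ ⌜ τ ⌝ ⟧ (λ τ′ → h (σ′ ∘ τ′)))
           (trans (⟦⌜⌝⟧ τ λ τ′ → h (σ ∘ τ′)) (sym (⟦⌜⌝⟧ (σ ∘ τ) h))))

  ⌜⌝-cong : ∀ {σ τ} → σ ≗ τ → ⌜ σ ⌝ ∼ ⌜ τ ⌝
  ⌜⌝-cong {σ} {τ} σ≗τ = mk∼ λ h h-ext → trans (⟦⌜⌝⟧ σ h) (trans (h-ext σ≗τ) (sym (⟦⌜⌝⟧ τ h)))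

  prodQS-++ : ∀ xs ys → prodQS (xs ++ ys) ∼ prodQS xs · prodQS ys
  prodQS-++ []       ys = ∼-sym (·-identityˡ (prodQS ys))
  prodQS-++ (x ∷ xs) ys =
    ∼-trans (·-congʳ x (prodQS-++ xs ys)) (∼-sym (·-assoc x (prodQS xs) (prodQS ys)))

  ++-cong : ∀ {x x′ y y′} → x ∼ x′ → y ∼ y′ → x ++ y ∼ x′ ++ y′
  ++-cong {x} {x′} {y} {y′} x∼x′ y∼y′ = mk∼ λ h h-ext →
    trans (⟦++⟧ x y h) (trans (cong₂ _+_ (run x∼x′ h h-ext) (run y∼y′ h h-ext)) (sym (⟦++⟧ x′ y′ h)))

  ++-identityʳ : ∀ x → x ++ [] ∼ x
  ++-identityʳ x = mk∼ λ h _ → trans (⟦++⟧ x [] h) (ℚP.+-identityʳ _)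

  ·-distribʳ-++ : ∀ x y z → (x ++ y) · z ∼ x · z ++ y · z
  ·-distribʳ-++ x y z = mk∼ λ h _ → begin
    ⟦ (x ++ y) · z ⟧ h                                                   ≡⟨ ⟦·⟧ (x ++ y) z h ⟩
    ⟦ x ++ y ⟧ (λ σ → ⟦ z ⟧ (λ τ → h (σ ∘ τ)))                           ≡⟨ ⟦++⟧ x y _ ⟩
    ⟦ x ⟧ (λ σ → ⟦ z ⟧ (λ τ → h (σ ∘ τ))) + ⟦ y ⟧ (λ σ → ⟦ z ⟧ (λ τ → h (σ ∘ τ)))
      ≡⟨ sym (cong₂ _+_ (⟦·⟧ x z h) (⟦·⟧ y z h)) ⟩
    ⟦ x · z ⟧ h + ⟦ y · z ⟧ h                                            ≡⟨ sym (⟦++⟧ (x · z) (y · z) h) ⟩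
    ⟦ x · z ++ y · z ⟧ h                                                 ∎

  scale-cong : ∀ c {x y} → x ∼ y → scale c x ∼ scale c y
  scale-cong c {x} {y} x∼y = mk∼ λ h h-ext →
    trans (⟦scale⟧ c x h) (trans (cong (c *_) (run x∼y h h-ext)) (sym (⟦scale⟧ c y h)))

  scale-·ˡ : ∀ c x y → scale c x · y ∼ scale c (x · y)
  scale-·ˡ c x y = mk∼ λ h _ → begin
    ⟦ scale c x · y ⟧ h                        ≡⟨ ⟦·⟧ (scale c x) y h ⟩
    ⟦ scale c x ⟧ (λ σ → ⟦ y ⟧ (λ τ → h (σ ∘ τ))) ≡⟨ ⟦scale⟧ c x _ ⟩
    c * ⟦ x ⟧ (λ σ → ⟦ y ⟧ (λ τ → h (σ ∘ τ)))    ≡⟨ cong (c *_) (sym (⟦·⟧ x y h)) ⟩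
    c * ⟦ x · y ⟧ h                             ≡⟨ sym (⟦scale⟧ c (x · y) h) ⟩
    ⟦ scale c (x · y) ⟧ h                      ∎

  scale-·ʳ : ∀ c x y → x · scale c y ∼ scale c (x · y)
  scale-·ʳ c x y = mk∼ λ h _ → begin
    ⟦ x · scale c y ⟧ h                              ≡⟨ ⟦·⟧ x (scale c y) h ⟩
    ⟦ x ⟧ (λ σ → ⟦ scale c y ⟧ (λ τ → h (σ ∘ τ)))    ≡⟨ ⟦⟧-cong x (λ σ → ⟦scale⟧ c y _) ⟩
    ⟦ x ⟧ (λ σ → c * ⟦ y ⟧ (λ τ → h (σ ∘ τ)))        ≡⟨ ⟦⟧-scale x c _ ⟩
    c * ⟦ x ⟧ (λ σ → ⟦ y ⟧ (λ τ → h (σ ∘ τ)))        ≡⟨ cong (c *_) (sym (⟦·⟧ x y h)) ⟩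
    c * ⟦ x · y ⟧ h                                   ≡⟨ sym (⟦scale⟧ c (x · y) h) ⟩
    ⟦ scale c (x · y) ⟧ h                            ∎

  ∼-neg⇒∼[] : ∀ {x} → x ∼ scale (- 1ℚ) x → x ∼ []
  ∼-neg⇒∼[] {x} x∼-x = mk∼ λ h h-ext → self-negating (trans (run x∼-x h h-ext)
    (trans (⟦scale⟧ (- 1ℚ) x h) (-1*x≈-x (⟦ x ⟧ h))))
    where
    self-negating : ∀ {a} → a ≡ - a → a ≡ 0ℚ
    self-negating {a} a≡-a = begin
      a                  ≡⟨ sym (ℚP.*-identityˡ a) ⟩
      1ℚ * a             ≡⟨ ℚP.*-distribʳ-+ a ℚ.½ ℚ.½ ⟩
      ℚ.½ * a + ℚ.½ * a  ≡⟨ sym (ℚP.*-distribˡ-+ ℚ.½ a a) ⟩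
      ℚ.½ * (a + a)      ≡⟨ cong (λ u → ℚ.½ * (a + u)) a≡-a ⟩
      ℚ.½ * (a + - a)    ≡⟨ cong (ℚ.½ *_) (ℚP.+-inverseʳ a) ⟩
      ℚ.½ * 0ℚ           ≡⟨ ℚP.*-zeroʳ ℚ.½ ⟩
      0ℚ                 ∎

  Terms : (Perm n → Set) → QS n → Set
  Terms P = All (P ∘ proj₂)

  Terms-· : ∀ {P Q R : Perm n → Set} → (∀ {σ τ} → P σ → Q τ → R (σ ∘ τ)) →
            ∀ {x y} → Terms P x → Terms Q y → Terms R (x · y)
  Terms-· combine tx ty =
    AllP.concat⁺ (AllP.map⁺ (All.map (λ pσ → AllP.map⁺ (All.map (combine pσ) ty)) tx))

  Terms-prodQS : ∀ {P : Perm n → Set} → P id → (∀ {σ τ} → P σ → P τ → P (σ ∘ τ)) →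
                 ∀ {xs} → All (Terms P) xs → Terms P (prodQS xs)
  Terms-prodQS P-id P-∘ []         = P-id ∷ []
  Terms-prodQS P-id P-∘ (tx ∷ txs) = Terms-· P-∘ tx (Terms-prodQS P-id P-∘ txs)

  ⟦⟧-cong-Terms : ∀ {x : QS n} {g g′} → Terms (λ σ → g σ ≡ g′ σ) x → ⟦ x ⟧ g ≡ ⟦ x ⟧ g′
  ⟦⟧-cong-Terms = ∑-cong-All ∘ All.map (λ {t} → cong (proj₁ t *_))

  ·-comm : ∀ x y → Terms (λ σ → Terms (λ τ → σ ∘ τ ≗ τ ∘ σ) y) x → x · y ∼ y · x
  ·-comm x y commute = mk∼ λ h h-ext → begin
    ⟦ x · y ⟧ h                                  ≡⟨ ⟦·⟧ x y h ⟩
    ⟦ x ⟧ (λ σ → ⟦ y ⟧ (λ τ → h (σ ∘ τ)))        ≡⟨ ⟦⟧-cong-Terms (All.map (⟦⟧-cong-Terms ∘ All.map h-ext) commute) ⟩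
    ⟦ x ⟧ (λ σ → ⟦ y ⟧ (λ τ → h (τ ∘ σ)))        ≡⟨ ⟦⟧-comm x y _ ⟩
    ⟦ y ⟧ (λ τ → ⟦ x ⟧ (λ σ → h (τ ∘ σ)))        ≡⟨ sym (⟦·⟧ y x h) ⟩
    ⟦ y · x ⟧ h                                  ∎

  ⟦·⟧-middle : ∀ x b y h → ⟦ x · (b · y) ⟧ h ≡ ⟦ b ⟧ (λ q → ⟦ x · (⌜ q ⌝ · y) ⟧ h)
  ⟦·⟧-middle x b y h = begin
    ⟦ x · (b · y) ⟧ h                                               ≡⟨ ⟦·⟧ x (b · y) h ⟩
    ⟦ x ⟧ (λ σ → ⟦ b · y ⟧ (λ ρ → h (σ ∘ ρ)))                        ≡⟨ ⟦⟧-cong x (λ σ → ⟦·⟧ b y _) ⟩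
    ⟦ x ⟧ (λ σ → ⟦ b ⟧ (λ q → ⟦ y ⟧ (λ τ → h (σ ∘ q ∘ τ))))          ≡⟨ ⟦⟧-comm x b _ ⟩
    ⟦ b ⟧ (λ q → ⟦ x ⟧ (λ σ → ⟦ y ⟧ (λ τ → h (σ ∘ q ∘ τ))))
      ≡⟨ ⟦⟧-cong b (λ q → sym (trans (⟦·⟧ x (⌜ q ⌝ · y) h) (⟦⟧-cong x λ σ →
           trans (⟦·⟧ ⌜ q ⌝ y _) (⟦⌜⌝⟧ q λ q′ → ⟦ y ⟧ (λ τ → h (σ ∘ q′ ∘ τ)))))) ⟩
    ⟦ b ⟧ (λ q → ⟦ x · (⌜ q ⌝ · y) ⟧ h)                              ∎

  ·-vanish-termwise : ∀ x b y → Terms (λ q → x · (⌜ q ⌝ · y) ∼ []) b → x · (b · y) ∼ []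
  ·-vanish-termwise x b y vanish = mk∼ λ h h-ext → trans (⟦·⟧-middle x b y h)
    (∑-zero-All (All.map (λ {t} v → trans (cong (proj₁ t *_) (run v h h-ext)) (ℚP.*-zeroʳ (proj₁ t))) vanish))

  -- Symmetrisers and antisymmetrisers

  open import Data.List.Membership.DecPropositional (_≟_ {n}) using (_∈?_)

  FixesOutside : List (Fin n) → Perm n → Set
  FixesOutside V σ = ∀ {x} → x ∉ V → σ x ≡ x

  Fixes : List (Fin n) → Perm n → Set
  Fixes V σ = ∀ {x} → x ∈ V → σ x ≡ x

  fixesᵇ : List (Fin n) → Perm n → Bool
  fixesᵇ V σ = all (λ x → memᵇ x V ∨ (σ x == x)) (allFin n)

  private
    ∨≡true : ∀ {a b} → a ∨ b ≡ true → a ≡ true ⊎ b ≡ true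
    ∨≡true {true}  _ = inj₁ refl
    ∨≡true {false} e = inj₂ e

    memᵇ⇒∈ : ∀ {x : Fin n} V → memᵇ x V ≡ true → x ∈ V
    memᵇ⇒∈ (u ∷ V) e with ∨≡true {u == _} e
    ... | inj₁ u==x = here (sym (==⇒≡ u==x))
    ... | inj₂ x∈V  = there (memᵇ⇒∈ V x∈V)

    ∈⇒memᵇ : ∀ {x : Fin n} V → x ∈ V → memᵇ x V ≡ true
    ∈⇒memᵇ {x} (u ∷ V) (here refl) rewrite ==-refl x = refl
    ∈⇒memᵇ {x} (u ∷ V) (there x∈V) rewrite ∈⇒memᵇ V x∈V = BoolP.∨-zeroʳ (u == x)

  fixesᵇ⇒ : ∀ V σ → fixesᵇ V σ ≡ true → FixesOutside V σ
  fixesᵇ⇒ V σ e {x} x∉V with ∨≡true {memᵇ x V} (all≡true⇒ _ (allFin n) e (∈-allFin x))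
  ... | inj₁ x∈V  = ⊥-elim (x∉V (memᵇ⇒∈ V x∈V))
  ... | inj₂ σx≡x = ==⇒≡ σx≡x

  ⇒fixesᵇ : ∀ V σ → FixesOutside V σ → fixesᵇ V σ ≡ true
  ⇒fixesᵇ V σ σ-fixes = all≡true⇐ _ (allFin n) λ {x} _ → by (x ∈? V)
    where
    by : ∀ {x} → Dec (x ∈ V) → (memᵇ x V ∨ (σ x == x)) ≡ true
    by {x} (yes x∈V) rewrite ∈⇒memᵇ V x∈V = refl
    by {x} (no x∉V)  rewrite ≡⇒== (σ-fixes x∉V) = BoolP.∨-zeroʳ (memᵇ x V)

  injectiveᵇ⇒ : ∀ σ → injectiveᵇ σ ≡ true → Injective _≡_ _≡_ σ
  injectiveᵇ⇒ σ e {x} {y} σx≡σy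
    with ∨≡true {not (σ x == σ y)} (all≡true⇒ _ (allFin n) (all≡true⇒ _ (allFin n) e (∈-allFin x)) (∈-allFin y))
  ... | inj₂ x==y = ==⇒≡ x==y
  ... | inj₁ σx≠σy rewrite ≡⇒== σx≡σy = case σx≠σy of λ ()

  ⇒injectiveᵇ : ∀ σ → Injective _≡_ _≡_ σ → injectiveᵇ σ ≡ true
  ⇒injectiveᵇ σ σ-inj =
    all≡true⇐ _ (allFin n) λ {x} _ → all≡true⇐ _ (allFin n) λ {y} _ → by (x ≟ y) (σ x ≟ σ y)
    where
    by : ∀ {x y} → Dec (x ≡ y) → Dec (σ x ≡ σ y) → (not (σ x == σ y) ∨ (x == y)) ≡ true
    by {x} {y} (yes x≡y) _ rewrite ≡⇒== x≡y = BoolP.∨-zeroʳ _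
    by (no x≢y) (yes σx≡σy) = ⊥-elim (x≢y (σ-inj σx≡σy))
    by (no x≢y) (no σx≢σy) rewrite ≢⇒== σx≢σy = refl

  InS : List (Fin n) → Perm n → Set
  InS V σ = Injective _≡_ _≡_ σ × FixesOutside V σ

  S-sound : ∀ V → All (InS V) (S V)
  S-sound V = All.zipWith member (injective-all , fixes-all)
    where
    injective-all : All (T ∘ injectiveᵇ) (S V)
    injective-all = AllP.filter⁺ (T? ∘ fixesᵇ V) (AllP.all-filter (T? ∘ injectiveᵇ) (allFuns n n))
    fixes-all : All (T ∘ fixesᵇ V) (S V)
    fixes-all = AllP.all-filter (T? ∘ fixesᵇ V) (allPerms n)
    member : ∀ {σ} → T (injectiveᵇ σ) × T (fixesᵇ V σ) → InS V σ
    member (inj , fix) = injectiveᵇ⇒ _ (T⇒≡ inj) , fixesᵇ⇒ V _ (T⇒≡ fix)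
      where
      T⇒≡ : ∀ {b} → T b → b ≡ true
      T⇒≡ = Equivalence.to BoolP.T-≡

  inS? : ∀ V σ → Dec (InS V σ)
  inS? V σ with injectiveᵇ σ in inj | fixesᵇ V σ in fix
  ... | true  | true  = yes (injectiveᵇ⇒ σ inj , fixesᵇ⇒ V σ fix)
  ... | false | _     = no λ (σ-inj , _) → case trans (sym inj) (⇒injectiveᵇ σ σ-inj) of λ ()
  ... | true  | false = no λ (_ , σ-fix) → case trans (sym fix) (⇒fixesᵇ V σ σ-fix) of λ ()

  -- The coefficient of σ in Σ_{τ ∈ S_V} w(τ) τ, as a function on all of allFuns n n.
  S-coeff : List (Fin n) → (Perm n → ℚ) → Perm n → ℚ
  S-coeff V w σ = 𝟙 (injectiveᵇ σ) * (𝟙 (fixesᵇ V σ) * w σ)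

  ⟦S⟧ : ∀ V w g → ⟦ map (λ σ → (w σ , σ)) (S V) ⟧ g ≡ ∑[ σ ← allFuns n n ] (S-coeff V w σ * g σ)
  ⟦S⟧ V w g = begin
    ⟦ map (λ σ → (w σ , σ)) (S V) ⟧ g                                  ≡⟨ ∑-map (S V) _ _ ⟩
    ∑[ σ ← S V ] (w σ * g σ)                           ≡⟨ ∑-filterᵇ (allPerms n) (fixesᵇ V) (λ σ → w σ * g σ) ⟩
    ∑[ σ ← allPerms n ] (𝟙 (fixesᵇ V σ) * (w σ * g σ))
      ≡⟨ ∑-filterᵇ (allFuns n n) injectiveᵇ (λ σ → 𝟙 (fixesᵇ V σ) * (w σ * g σ)) ⟩
    ∑[ σ ← allFuns n n ] (𝟙 (injectiveᵇ σ) * (𝟙 (fixesᵇ V σ) * (w σ * g σ)))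
      ≡⟨ ∑-cong (allFuns n n) (λ σ → trans (cong (𝟙 (injectiveᵇ σ) *_) (sym (ℚP.*-assoc (𝟙 (fixesᵇ V σ)) (w σ) (g σ))))
                                           (sym (ℚP.*-assoc (𝟙 (injectiveᵇ σ)) (𝟙 (fixesᵇ V σ) * w σ) (g σ)))) ⟩
    ∑[ σ ← allFuns n n ] (S-coeff V w σ * g σ)                              ∎

  S-coeff-member : ∀ {V σ} w → InS V σ → S-coeff V w σ ≡ w σ
  S-coeff-member {V} {σ} w (σ-inj , σ-fix) rewrite ⇒injectiveᵇ σ σ-inj | ⇒fixesᵇ V σ σ-fix =
    trans (ℚP.*-identityˡ _) (ℚP.*-identityˡ (w σ))

  S-coeff-nonmember : ∀ {V σ} w → ¬ InS V σ → S-coeff V w σ ≡ 0ℚ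
  S-coeff-nonmember {V} {σ} w ¬member with injectiveᵇ σ in inj | fixesᵇ V σ in fix
  ... | true  | true  = ⊥-elim (¬member (injectiveᵇ⇒ σ inj , fixesᵇ⇒ V σ fix))
  ... | false | b     = ℚP.*-zeroˡ (𝟙 b * w σ)
  ... | true  | false = trans (ℚP.*-identityˡ _) (ℚP.*-zeroˡ (w σ))

  InS-cong : ∀ {V σ τ} → σ ≗ τ → InS V σ → InS V τ
  InS-cong σ≗τ (σ-inj , σ-fix) =
    (λ {x} {y} τx≡τy → σ-inj (trans (σ≗τ x) (trans τx≡τy (sym (σ≗τ y))))) ,
    (λ {x} x∉V → trans (sym (σ≗τ x)) (σ-fix x∉V))

  S-coeff-extensional : ∀ V {w} → Extensional w → Extensional (S-coeff V w)
  S-coeff-extensional V {w} w-ext {σ} {τ} σ≗τ with inS? V σ | inS? V τ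
  ... | yes σ∈ | yes τ∈ = trans (S-coeff-member w σ∈) (trans (w-ext σ≗τ) (sym (S-coeff-member w τ∈)))
  ... | yes σ∈ | no τ∉  = ⊥-elim (τ∉ (InS-cong σ≗τ σ∈))
  ... | no σ∉  | yes τ∈ = ⊥-elim (σ∉ (InS-cong (sym ∘ σ≗τ) τ∈))
  ... | no σ∉  | no τ∉  = trans (S-coeff-nonmember w σ∉) (sym (S-coeff-nonmember w τ∉))

  InS-mono : ∀ {V W σ} → (∀ {x} → x ∈ V → x ∈ W) → InS V σ → InS W σ
  InS-mono V⊆W (σ-inj , σ-fix) = σ-inj , λ x∉W → σ-fix (x∉W ∘ V⊆W)

  InS-swap∘ : ∀ {V σ a b} → a ∈ V → b ∈ V → InS V σ → InS V (swap a b ∘ σ)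
  InS-swap∘ {a = a} {b} a∈V b∈V (σ-inj , σ-fix) = σ-inj ∘ swap-injective a b , λ {x} x∉V →
    trans (cong (swap a b) (σ-fix x∉V)) (swap-fixes a b x (∉⇒≢ a∈V x∉V) (∉⇒≢ b∈V x∉V))

  InS-∘swap : ∀ {V σ a b} → a ∈ V → b ∈ V → InS V σ → InS V (σ ∘ swap a b)
  InS-∘swap {σ = σ} {a} {b} a∈V b∈V (σ-inj , σ-fix) = swap-injective a b ∘ σ-inj , λ {x} x∉V →
    trans (cong σ (swap-fixes a b x (∉⇒≢ a∈V x∉V) (∉⇒≢ b∈V x∉V))) (σ-fix x∉V)

  S-coeff-∘swap : ∀ {U a b} σ → a ≢ b → a ∈ U → b ∈ U → S-coeff U sgn (σ ∘ swap a b) ≡ - S-coeff U sgn σ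
  S-coeff-∘swap {U} {a} {b} σ a≢b a∈U b∈U with inS? U σ
  ... | yes σ∈ = trans (S-coeff-member sgn (InS-∘swap a∈U b∈U σ∈))
    (trans (sgn-∘-swap (proj₁ σ∈) a≢b) (cong -_ (sym (S-coeff-member sgn σ∈))))
  ... | no σ∉ = trans (S-coeff-nonmember sgn (σ∉ ∘ undo)) (sym (cong -_ (S-coeff-nonmember sgn σ∉)))
    where
    undo : InS U (σ ∘ swap a b) → InS U σ
    undo m = InS-cong (cong σ ∘ swap-involutive a b) (InS-∘swap a∈U b∈U m)

  S-coeff-swap∘ : ∀ {U a b} ρ → a ∈ U → b ∈ U → S-coeff U (λ _ → 1ℚ) (swap a b ∘ ρ) ≡ S-coeff U (λ _ → 1ℚ) ρ
  S-coeff-swap∘ {U} {a} {b} ρ a∈U b∈U with inS? U ρ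
  ... | yes ρ∈ = trans (S-coeff-member (λ _ → 1ℚ) (InS-swap∘ a∈U b∈U ρ∈)) (sym (S-coeff-member (λ _ → 1ℚ) ρ∈))
  ... | no ρ∉ = trans (S-coeff-nonmember (λ _ → 1ℚ) (ρ∉ ∘ undo)) (sym (S-coeff-nonmember (λ _ → 1ℚ) ρ∉))
    where
    undo : InS U (swap a b ∘ ρ) → InS U ρ
    undo m = InS-cong (swap-involutive a b ∘ ρ) (InS-swap∘ a∈U b∈U m)

  asym-·-swap : ∀ {U a b} → a ≢ b → a ∈ U → b ∈ U → asym[ U ] · ⌜ swap a b ⌝ ∼ scale (- 1ℚ) asym[ U ]
  asym-·-swap {U} {a} {b} a≢b a∈U b∈U = mk∼ λ h h-ext → begin
    ⟦ asym[ U ] · ⌜ s ⌝ ⟧ h                              ≡⟨ ⟦·⟧ asym[ U ] ⌜ s ⌝ h ⟩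
    ⟦ asym[ U ] ⟧ (λ σ → ⟦ ⌜ s ⌝ ⟧ (λ τ → h (σ ∘ τ)))    ≡⟨ ⟦⟧-cong asym[ U ] (λ σ → ⟦⌜⌝⟧ s λ τ → h (σ ∘ τ)) ⟩
    ⟦ asym[ U ] ⟧ (λ σ → h (σ ∘ s))                      ≡⟨ ⟦S⟧ U sgn _ ⟩
    ∑[ σ ← allFuns n n ] (S-coeff U sgn σ * h (σ ∘ s))
      ≡⟨ ∑-cong (allFuns n n) (λ σ → cong (_* h (σ ∘ s))
           (S-coeff-extensional U sgn-cong (sym ∘ cong σ ∘ swap-involutive a b))) ⟩
    ∑[ σ ← allFuns n n ] (S-coeff U sgn (σ ∘ s ∘ s) * h (σ ∘ s))
      ≡⟨ ∑-allPerms-∘swap (λ σ → S-coeff U sgn (σ ∘ s) * h σ)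
           (λ σ≗τ → cong₂ _*_ (S-coeff-extensional U sgn-cong (σ≗τ ∘ s)) (h-ext σ≗τ)) a b ⟩
    ∑[ σ ← allFuns n n ] (S-coeff U sgn (σ ∘ s) * h σ)
      ≡⟨ ∑-cong (allFuns n n) (λ σ → trans (cong (_* h σ) (S-coeff-∘swap σ a≢b a∈U b∈U))
                                            (sym (ℚP.neg-distribˡ-* (S-coeff U sgn σ) (h σ)))) ⟩
    ∑[ σ ← allFuns n n ] (- (S-coeff U sgn σ * h σ))         ≡⟨ ∑-neg (allFuns n n) _ ⟩
    - ∑[ σ ← allFuns n n ] (S-coeff U sgn σ * h σ)           ≡⟨ cong -_ (sym (⟦S⟧ U sgn h)) ⟩
    - ⟦ asym[ U ] ⟧ h                                    ≡⟨ sym (trans (⟦scale⟧ (- 1ℚ) asym[ U ] h) (-1*x≈-x _)) ⟩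
    ⟦ scale (- 1ℚ) asym[ U ] ⟧ h                         ∎
    where
    s = swap a b

  ∑-swap∘-shift : ∀ V {w} → Extensional w → ∀ {h} → Extensional h → ∀ a b →
    ∑[ σ ← allFuns n n ] (S-coeff V w σ * h (swap a b ∘ σ))
    ≡ ∑[ σ ← allFuns n n ] (S-coeff V w (swap a b ∘ σ) * h σ)
  ∑-swap∘-shift V {w} w-ext {h} h-ext a b = begin
    ∑[ σ ← allFuns n n ] (S-coeff V w σ * h (s ∘ σ))
      ≡⟨ ∑-cong (allFuns n n) (λ σ → cong (_* h (s ∘ σ))
           (S-coeff-extensional V w-ext (sym ∘ swap-involutive a b ∘ σ))) ⟩
    ∑[ σ ← allFuns n n ] (S-coeff V w (s ∘ (s ∘ σ)) * h (s ∘ σ))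
      ≡⟨ ∑-allPerms-swap∘ (λ σ → S-coeff V w (s ∘ σ) * h σ)
           (λ σ≗τ → cong₂ _*_ (S-coeff-extensional V w-ext (cong s ∘ σ≗τ)) (h-ext σ≗τ)) a b ⟩
    ∑[ σ ← allFuns n n ] (S-coeff V w (s ∘ σ) * h σ) ∎
    where
    s = swap a b

  swap-·-sym : ∀ {R a b} → a ∈ R → b ∈ R → ⌜ swap a b ⌝ · sym[ R ] ∼ sym[ R ]
  swap-·-sym {R} {a} {b} a∈R b∈R = mk∼ λ h h-ext → begin
    ⟦ ⌜ s ⌝ · sym[ R ] ⟧ h                            ≡⟨ ⟦·⟧ ⌜ s ⌝ sym[ R ] h ⟩
    ⟦ ⌜ s ⌝ ⟧ (λ σ → ⟦ sym[ R ] ⟧ (λ τ → h (σ ∘ τ)))  ≡⟨ ⟦⌜⌝⟧ s (λ σ → ⟦ sym[ R ] ⟧ (λ τ → h (σ ∘ τ))) ⟩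
    ⟦ sym[ R ] ⟧ (λ τ → h (s ∘ τ))                    ≡⟨ ⟦S⟧ R (λ _ → 1ℚ) _ ⟩
    ∑[ ρ ← allFuns n n ] (S-coeff R (λ _ → 1ℚ) ρ * h (s ∘ ρ))
      ≡⟨ ∑-swap∘-shift R (λ _ → refl) h-ext a b ⟩
    ∑[ ρ ← allFuns n n ] (S-coeff R (λ _ → 1ℚ) (s ∘ ρ) * h ρ)
      ≡⟨ ∑-cong (allFuns n n) (λ ρ → cong (_* h ρ) (S-coeff-swap∘ ρ a∈R b∈R)) ⟩
    ∑[ ρ ← allFuns n n ] (S-coeff R (λ _ → 1ℚ) ρ * h ρ)   ≡⟨ sym (⟦S⟧ R (λ _ → 1ℚ) h) ⟩
    ⟦ sym[ R ] ⟧ h                                    ∎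
    where
    s = swap a b

  ∑-S-coeff-swap∘-InS : ∀ {C y σ} → y ∉ C → InS C σ → ∑[ t ← C ] S-coeff C sgn (swap t y ∘ σ) ≡ 0ℚ
  ∑-S-coeff-swap∘-InS {C} {y} {σ} y∉C (_ , σ-fix) =
    ∑-zero-All (All.tabulate λ t∈C → S-coeff-nonmember sgn (moves-y t∈C))
    where
    moves-y : ∀ {t} → t ∈ C → ¬ InS C (swap t y ∘ σ)
    moves-y {t} t∈C (_ , fix) = y∉C (subst (_∈ C)
      (trans (sym (swap-β₂ t y)) (trans (cong (swap t y) (sym (σ-fix y∉C))) (fix y∉C))) t∈C)

  ∑-S-coeff-swap∘-∉InS : ∀ {C y σ} → ¬ InS (y ∷ C) σ → ∑[ t ← C ] S-coeff C sgn (swap t y ∘ σ) ≡ 0ℚ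
  ∑-S-coeff-swap∘-∉InS {C} {y} {σ} σ∉ =
    ∑-zero-All (All.tabulate λ t∈C → S-coeff-nonmember sgn (σ∉ ∘ undo t∈C))
    where
    undo : ∀ {t} → t ∈ C → InS C (swap t y ∘ σ) → InS (y ∷ C) σ
    undo {t} t∈C m =
      InS-cong (swap-involutive t y ∘ σ) (InS-swap∘ (there t∈C) (here refl) (InS-mono there m))

  -- Only t = σ y contributes: swap (σ y) y ∘ σ is the element of S_C in the coset of σ.
  ∑-S-coeff-swap∘-coset : ∀ {C y σ} → Unique C → y ∉ C → ¬ InS C σ → InS (y ∷ C) σ →
                          ∑[ t ← C ] S-coeff C sgn (swap t y ∘ σ) ≡ - sgn σ
  ∑-S-coeff-swap∘-coset {C} {y} {σ} C-unique y∉C σ∉C (σ-inj , σ-fix) =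
    trans (∑-unique-support C-unique t₀∈C others)
          (trans (S-coeff-member sgn InS₀) (sgn-swap-∘ σ-inj t₀≢y))
    where
    t₀ = σ y
    outside : ∀ {x} → x ∉ C → x ≢ y → x ∉ y ∷ C
    outside x∉C x≢y (here x≡y)  = x≢y x≡y
    outside x∉C x≢y (there x∈C) = x∉C x∈C
    t₀≢y : t₀ ≢ y
    t₀≢y t₀≡y = σ∉C (σ-inj , λ {x} x∉C → case x ≟ y of λ where
      (yes refl) → t₀≡y
      (no x≢y)   → σ-fix (outside x∉C x≢y))
    t₀∈C : t₀ ∈ C
    t₀∈C with t₀ ∈? C
    ... | yes t₀∈C = t₀∈C
    ... | no t₀∉C  = ⊥-elim (t₀≢y (σ-inj (σ-fix (outside t₀∉C t₀≢y))))
    InS₀ : InS C (swap t₀ y ∘ σ)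
    InS₀ = σ-inj ∘ swap-injective t₀ y , λ {x} x∉C → case x ≟ y of λ where
      (yes refl) → swap-β₁ t₀ y
      (no x≢y)   → trans (cong (swap t₀ y) (σ-fix (outside x∉C x≢y)))
                         (swap-fixes t₀ y x (∉⇒≢ t₀∈C x∉C) x≢y)
    others : ∀ {t} → t ∈ C → t ≢ t₀ → S-coeff C sgn (swap t y ∘ σ) ≡ 0ℚ
    others {t} t∈C t≢t₀ = S-coeff-nonmember sgn λ (_ , fix) →
      t₀≢y (trans (sym (swap-fixes t y t₀ (t≢t₀ ∘ sym) t₀≢y)) (fix y∉C))

  -- Coefficientwise form of the coset decomposition [y ∷ C]' = (1 - Σ_{t ∈ C} (t y)) [C]'.
  S-coeff-coset : ∀ {C y} → Unique C → y ∉ C → ∀ σ →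
                  ∑[ t ← C ] S-coeff C sgn (swap t y ∘ σ) + S-coeff (y ∷ C) sgn σ ≡ S-coeff C sgn σ
  S-coeff-coset {C} {y} C-unique y∉C σ with inS? C σ | inS? (y ∷ C) σ
  ... | yes σ∈C | _ = begin
    ∑[ t ← C ] S-coeff C sgn (swap t y ∘ σ) + S-coeff (y ∷ C) sgn σ
      ≡⟨ cong₂ _+_ (∑-S-coeff-swap∘-InS y∉C σ∈C) (S-coeff-member sgn (InS-mono there σ∈C)) ⟩
    0ℚ + sgn σ       ≡⟨ ℚP.+-identityˡ _ ⟩
    sgn σ            ≡⟨ sym (S-coeff-member sgn σ∈C) ⟩
    S-coeff C sgn σ  ∎
  ... | no σ∉C | no σ∉yC = begin
    ∑[ t ← C ] S-coeff C sgn (swap t y ∘ σ) + S-coeff (y ∷ C) sgn σ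
      ≡⟨ cong₂ _+_ (∑-S-coeff-swap∘-∉InS σ∉yC) (S-coeff-nonmember sgn σ∉yC) ⟩
    0ℚ + 0ℚ          ≡⟨ sym (S-coeff-nonmember sgn σ∉C) ⟩
    S-coeff C sgn σ  ∎
  ... | no σ∉C | yes σ∈yC = begin
    ∑[ t ← C ] S-coeff C sgn (swap t y ∘ σ) + S-coeff (y ∷ C) sgn σ
      ≡⟨ cong₂ _+_ (∑-S-coeff-swap∘-coset C-unique y∉C σ∉C σ∈yC) (S-coeff-member sgn σ∈yC) ⟩
    - sgn σ + sgn σ  ≡⟨ ℚP.+-inverseˡ (sgn σ) ⟩
    0ℚ               ≡⟨ sym (S-coeff-nonmember sgn σ∉C) ⟩
    S-coeff C sgn σ  ∎

  transpositionSum : List (Fin n) → Fin n → QS n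
  transpositionSum C y = map (λ x → (1ℚ , swap x y)) C

  asym-coset : ∀ {C y} → Unique C → y ∉ C →
               transpositionSum C y · asym[ C ] ++ asym[ y ∷ C ] ∼ asym[ C ]
  asym-coset {C} {y} C-unique y∉C = mk∼ λ h h-ext → begin
    ⟦ τs · asym[ C ] ++ asym[ y ∷ C ] ⟧ h
      ≡⟨ ⟦++⟧ (τs · asym[ C ]) asym[ y ∷ C ] h ⟩
    ⟦ τs · asym[ C ] ⟧ h + ⟦ asym[ y ∷ C ] ⟧ h
      ≡⟨ cong (_+ ⟦ asym[ y ∷ C ] ⟧ h) (trans (⟦·⟧ τs asym[ C ] h) (∑-map C _ _)) ⟩
    ∑[ t ← C ] (1ℚ * ⟦ asym[ C ] ⟧ (λ σ → h (swap t y ∘ σ))) + ⟦ asym[ y ∷ C ] ⟧ h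
      ≡⟨ cong₂ _+_ (∑-cong C λ t → trans (ℚP.*-identityˡ _) (trans (⟦S⟧ C sgn _)
                      (∑-swap∘-shift C sgn-cong h-ext t y)))
                   (⟦S⟧ (y ∷ C) sgn h) ⟩
    (∑[ t ← C ] ∑[ σ ← allFuns n n ] (S-coeff C sgn (swap t y ∘ σ) * h σ))
      + ∑[ σ ← allFuns n n ] (S-coeff (y ∷ C) sgn σ * h σ)
      ≡⟨ cong (_+ ∑[ σ ← allFuns n n ] (S-coeff (y ∷ C) sgn σ * h σ))
           (trans (∑-comm C (allFuns n n) _) (∑-cong (allFuns n n) λ σ → ∑-distribʳ C (h σ) _)) ⟩
    ∑[ σ ← allFuns n n ] ((∑[ t ← C ] S-coeff C sgn (swap t y ∘ σ)) * h σ)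
      + ∑[ σ ← allFuns n n ] (S-coeff (y ∷ C) sgn σ * h σ)
      ≡⟨ sym (∑-distrib-+ (allFuns n n) _ _) ⟩
    ∑[ σ ← allFuns n n ] ((∑[ t ← C ] S-coeff C sgn (swap t y ∘ σ)) * h σ + S-coeff (y ∷ C) sgn σ * h σ)
      ≡⟨ ∑-cong (allFuns n n) (λ σ → trans (sym (ℚP.*-distribʳ-+ (h σ) (∑[ t ← C ] S-coeff C sgn (swap t y ∘ σ)) _))
                                           (cong (_* h σ) (S-coeff-coset C-unique y∉C σ))) ⟩
    ∑[ σ ← allFuns n n ] (S-coeff C sgn σ * h σ)
      ≡⟨ sym (⟦S⟧ C sgn h) ⟩
    ⟦ asym[ C ] ⟧ h ∎
    where
    τs = transpositionSum C y

  asym-terms : ∀ V → Terms (InS V) asym[ V ]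
  asym-terms V = AllP.map⁺ (S-sound V)

  sym-terms : ∀ V → Terms (InS V) sym[ V ]
  sym-terms V = AllP.map⁺ (S-sound V)

  swap-commutes : ∀ {σ : Perm n} → Injective _≡_ _≡_ σ → ∀ {a b} → σ a ≡ a → σ b ≡ b →
                  σ ∘ swap a b ≗ swap a b ∘ σ
  swap-commutes {σ} σ-inj {a} {b} σa≡a σb≡b x =
    trans (swap-conjugate σ-inj a b x) (cong₂ (λ u v → swap u v (σ x)) σa≡a σb≡b)

  swap-·-rows : ∀ {Rs a b} → Unique (concat Rs) → Any (λ R → a ∈ R × b ∈ R) Rs →
                ⌜ swap a b ⌝ · prodQS (map sym[_] Rs) ∼ prodQS (map sym[_] Rs)
  swap-·-rows {R ∷ Rs} {a} {b} _ (here (a∈R , b∈R)) =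
    ∼-trans (∼-sym (·-assoc ⌜ swap a b ⌝ sym[ R ] _)) (·-congˡ _ (swap-·-sym a∈R b∈R))
  swap-·-rows {R ∷ Rs} {a} {b} u (there same-row) with Unique-++⁻ R u
  ... | _ , u-Rs , disjoint = begin∼
    ⌜ s ⌝ · (sym[ R ] · rest)   ≈⟨ ∼-sym (·-assoc ⌜ s ⌝ sym[ R ] rest) ⟩
    (⌜ s ⌝ · sym[ R ]) · rest   ≈⟨ ·-congˡ rest (·-comm ⌜ s ⌝ sym[ R ] (commute ∷ [])) ⟩
    (sym[ R ] · ⌜ s ⌝) · rest   ≈⟨ ·-assoc sym[ R ] ⌜ s ⌝ rest ⟩
    sym[ R ] · (⌜ s ⌝ · rest)   ≈⟨ ·-congʳ sym[ R ] (swap-·-rows u-Rs same-row) ⟩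
    sym[ R ] · rest             ∎∼
    where
    s = swap a b
    rest = prodQS (map sym[_] Rs)
    a∉R : a ∉ R
    a∉R a∈R = disjoint (a∈R , ∈-concat⁺ proj₁ same-row)
    b∉R : b ∉ R
    b∉R b∈R = disjoint (b∈R , ∈-concat⁺ proj₂ same-row)
    commute : Terms (λ τ → s ∘ τ ≗ τ ∘ s) sym[ R ]
    commute = All.map (λ (τ-inj , τ-fix) x → sym (swap-commutes τ-inj (τ-fix a∉R) (τ-fix b∉R) x))
                      (sym-terms R)

  asym-·-vanish : ∀ {U a y q τ} Y → a ≢ y → a ∈ U → y ∈ U → q ∘ τ ≗ swap a y ∘ q → ⌜ τ ⌝ · Y ∼ Y →
                  asym[ U ] · (⌜ q ⌝ · Y) ∼ []
  asym-·-vanish {U} {a} {y} {q} {τ} Y a≢y a∈U y∈U qτ≗sq τY∼Y = ∼-neg⇒∼[] (begin∼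
    asym[ U ] · (⌜ q ⌝ · Y)                ≈⟨ ·-congʳ asym[ U ] (·-congʳ ⌜ q ⌝ (∼-sym τY∼Y)) ⟩
    asym[ U ] · (⌜ q ⌝ · (⌜ τ ⌝ · Y))      ≈⟨ ·-congʳ asym[ U ] (∼-sym (·-assoc ⌜ q ⌝ ⌜ τ ⌝ Y)) ⟩
    asym[ U ] · ((⌜ q ⌝ · ⌜ τ ⌝) · Y)      ≈⟨ ·-congʳ asym[ U ] (·-congˡ Y qτ∼sq) ⟩
    asym[ U ] · ((⌜ s ⌝ · ⌜ q ⌝) · Y)      ≈⟨ ·-congʳ asym[ U ] (·-assoc ⌜ s ⌝ ⌜ q ⌝ Y) ⟩
    asym[ U ] · (⌜ s ⌝ · (⌜ q ⌝ · Y))      ≈⟨ ∼-sym (·-assoc asym[ U ] ⌜ s ⌝ (⌜ q ⌝ · Y)) ⟩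
    (asym[ U ] · ⌜ s ⌝) · (⌜ q ⌝ · Y)      ≈⟨ ·-congˡ (⌜ q ⌝ · Y) (asym-·-swap a≢y a∈U y∈U) ⟩
    scale (- 1ℚ) asym[ U ] · (⌜ q ⌝ · Y)   ≈⟨ scale-·ˡ (- 1ℚ) asym[ U ] (⌜ q ⌝ · Y) ⟩
    scale (- 1ℚ) (asym[ U ] · (⌜ q ⌝ · Y)) ∎∼)
    where
    s = swap a y
    qτ∼sq : ⌜ q ⌝ · ⌜ τ ⌝ ∼ ⌜ s ⌝ · ⌜ q ⌝
    qτ∼sq = ∼-trans (⌜⌝-∘ q τ) (∼-trans (⌜⌝-cong qτ≗sq) (∼-sym (⌜⌝-∘ s q)))

  transpositionSum-absorbed : ∀ {C y} Z → Unique C → y ∉ C → asym[ y ∷ C ] · Z ∼ [] →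
                              transpositionSum C y · (asym[ C ] · Z) ∼ asym[ C ] · Z
  transpositionSum-absorbed {C} {y} Z C-unique y∉C vanish = begin∼
    τs · (asym[ C ] · Z)                     ≈⟨ ∼-sym (·-assoc τs asym[ C ] Z) ⟩
    (τs · asym[ C ]) · Z                     ≈⟨ ∼-sym (++-identityʳ _) ⟩
    (τs · asym[ C ]) · Z ++ []               ≈⟨ ++-cong ∼-refl (∼-sym vanish) ⟩
    (τs · asym[ C ]) · Z ++ asym[ y ∷ C ] · Z ≈⟨ ∼-sym (·-distribʳ-++ (τs · asym[ C ]) asym[ y ∷ C ] Z) ⟩
    (τs · asym[ C ] ++ asym[ y ∷ C ]) · Z    ≈⟨ ·-congˡ Z (asym-coset C-unique y∉C) ⟩
    asym[ C ] · Z                            ∎∼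
    where
    τs = transpositionSum C y

  InS⇒∈ : ∀ {V σ v} → InS V σ → v ∈ V → σ v ∈ V
  InS⇒∈ {V} {σ} {v} (σ-inj , σ-fix) v∈V with σ v ∈? V
  ... | yes σv∈V = σv∈V
  ... | no σv∉V  = ⊥-elim (σv∉V (subst (_∈ V) (sym (σ-inj (σ-fix σv∉V))) v∈V))

  Reflects : List (Fin n) → Perm n → Set
  Reflects W σ = ∀ {v} → σ v ∈ W → v ∈ W

  Fixes-∘ : ∀ {W σ τ} → Fixes W σ → Fixes W τ → Fixes W (σ ∘ τ)
  Fixes-∘ {σ = σ} σ-fix τ-fix x∈W = trans (cong σ (τ-fix x∈W)) (σ-fix x∈W)

  Reflects-∘ : ∀ {W σ τ} → Reflects W σ → Reflects W τ → Reflects W (σ ∘ τ)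
  Reflects-∘ σ-refl τ-refl = τ-refl ∘ σ-refl

  Injective-id : Injective _≡_ _≡_ (id {A = Fin n})
  Injective-id e = e

  Injective-∘ : ∀ {σ τ : Perm n} → Injective _≡_ _≡_ σ → Injective _≡_ _≡_ τ → Injective _≡_ _≡_ (σ ∘ τ)
  Injective-∘ σ-inj τ-inj = τ-inj ∘ σ-inj

  InS⇒Fixes : ∀ {V W σ} → Disjoint V W → InS V σ → Fixes W σ
  InS⇒Fixes V#W (_ , σ-fix) x∈W = σ-fix λ x∈V → V#W (x∈V , x∈W)

  transpositionSum-·-comm : ∀ {C y} As → All (λ V → Disjoint V (y ∷ C)) As →
    transpositionSum C y · prodQS (map asym[_] As) ∼ prodQS (map asym[_] As) · transpositionSum C y
  transpositionSum-·-comm {C} {y} As disjoint = ·-comm (transpositionSum C y) (prodQS (map asym[_] As))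
    (AllP.map⁺ (All.tabulate λ {t} t∈C → All.map (λ (σ-inj , σ-fix) x →
      sym (swap-commutes σ-inj (σ-fix (there t∈C)) (σ-fix (here refl)) x)) fixers))
    where
    Fixer : Perm n → Set
    Fixer σ = Injective _≡_ _≡_ σ × Fixes (y ∷ C) σ
    Fixer-id : Fixer id
    Fixer-id = Injective-id , λ _ → refl
    Fixer-∘ : ∀ {σ τ} → Fixer σ → Fixer τ → Fixer (σ ∘ τ)
    Fixer-∘ (σ-inj , σ-fix) (τ-inj , τ-fix) = Injective-∘ σ-inj τ-inj , Fixes-∘ σ-fix τ-fix
    fixers : Terms Fixer (prodQS (map asym[_] As))
    fixers = Terms-prodQS Fixer-id Fixer-∘ (AllP.map⁺ (All.map fixers-of disjoint))
      where
      fixers-of : ∀ {V} → Disjoint V (y ∷ C) → Terms Fixer asym[ V ]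
      fixers-of {V} V#yC = All.map fixer (asym-terms V)
        where
        fixer : ∀ {σ} → InS V σ → Fixer σ
        fixer m = proj₁ m , InS⇒Fixes V#yC m

  asym-·-vanish-after : ∀ {C y Cj} Bs Rs → y ∉ C → y ∈ Cj →
    All (λ V → Disjoint V C × (V ≡ Cj ⊎ Disjoint V Cj)) Bs →
    (∀ {z} → z ∈ Cj → ∃ λ w → w ∈ C × Any (λ R → w ∈ R × z ∈ R) Rs) → Unique (concat Rs) →
    asym[ y ∷ C ] · (prodQS (map asym[_] Bs) · prodQS (map sym[_] Rs)) ∼ []
  asym-·-vanish-after {C} {y} {Cj} Bs Rs y∉C y∈Cj columns partner rows-unique =
    ·-vanish-termwise asym[ y ∷ C ] B rows (All.map vanish stable)
    where
    B = prodQS (map asym[_] Bs)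
    rows = prodQS (map sym[_] Rs)
    Stable : Perm n → Set
    Stable σ = Injective _≡_ _≡_ σ × Fixes C σ × Reflects Cj σ
    Stable-id : Stable id
    Stable-id = Injective-id , (λ _ → refl) , id
    Stable-∘ : ∀ {σ τ} → Stable σ → Stable τ → Stable (σ ∘ τ)
    Stable-∘ (σ-inj , σ-fix , σ-refl) (τ-inj , τ-fix , τ-refl) =
      Injective-∘ σ-inj τ-inj , Fixes-∘ σ-fix τ-fix , Reflects-∘ {Cj} σ-refl τ-refl
    reflects : ∀ {V σ} → V ≡ Cj ⊎ Disjoint V Cj → InS V σ → Reflects Cj σ
    reflects {V} {σ} alt m {v} σv∈Cj with v ∈? V | alt
    ... | yes v∈V | inj₁ refl  = v∈V
    ... | yes v∈V | inj₂ V#Cj = ⊥-elim (V#Cj (InS⇒∈ m v∈V , σv∈Cj))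
    ... | no v∉V  | _          = subst (_∈ Cj) (proj₂ m v∉V) σv∈Cj
    stable : Terms Stable B
    stable = Terms-prodQS Stable-id Stable-∘ (AllP.map⁺ (All.map stable-of columns))
      where
      stable-of : ∀ {V} → Disjoint V C × (V ≡ Cj ⊎ Disjoint V Cj) → Terms Stable asym[ V ]
      stable-of {V} (V#C , alt) = All.map InS⇒Stable (asym-terms V)
        where
        InS⇒Stable : ∀ {σ} → InS V σ → Stable σ
        InS⇒Stable m = proj₁ m , InS⇒Fixes V#C m , reflects alt m
    vanish : ∀ {q} → Stable q → asym[ y ∷ C ] · (⌜ q ⌝ · rows) ∼ []
    vanish {q} (q-inj , q-fix , q-refl) with injective⇒surjective q-inj y
    ... | z , qz≡y with partner (q-refl (subst (_∈ Cj) (sym qz≡y) y∈Cj))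
    ...   | w , w∈C , same-row =
      asym-·-vanish {y ∷ C} {w} {y} {q} {swap w z} rows (∉⇒≢ w∈C y∉C ∘ sym) (there w∈C) (here refl)
        conjugate (swap-·-rows rows-unique same-row)
      where
      conjugate : q ∘ swap w z ≗ swap w y ∘ q
      conjugate x = trans (swap-conjugate q-inj w z x) (cong₂ (λ u v → swap u v (q x)) (q-fix w∈C) qz≡y)

  transpositionSum-·-columns : ∀ {C y Cj} As Bs Rs → Unique C → y ∉ C → y ∈ Cj →
    All (λ V → Disjoint V (y ∷ C)) As →
    All (λ V → Disjoint V C × (V ≡ Cj ⊎ Disjoint V Cj)) Bs →
    (∀ {z} → z ∈ Cj → ∃ λ w → w ∈ C × Any (λ R → w ∈ R × z ∈ R) Rs) → Unique (concat Rs) →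
    let NP = prodQS (map asym[_] As ++ asym[ C ] ∷ map asym[_] Bs) · prodQS (map sym[_] Rs)
    in transpositionSum C y · NP ∼ NP
  transpositionSum-·-columns {C} {y} As Bs Rs C-unique y∉C y∈Cj before after partner rows-unique = begin∼
    τs · NP        ≈⟨ ·-congʳ τs NP∼AZ ⟩
    τs · (A · Z)   ≈⟨ ∼-sym (·-assoc τs A Z) ⟩
    (τs · A) · Z   ≈⟨ ·-congˡ Z (transpositionSum-·-comm As before) ⟩
    (A · τs) · Z   ≈⟨ ·-assoc A τs Z ⟩
    A · (τs · Z)   ≈⟨ ·-congʳ A (transpositionSum-absorbed (B · rows) C-unique y∉C
                        (asym-·-vanish-after Bs Rs y∉C y∈Cj after partner rows-unique)) ⟩
    A · Z          ≈⟨ ∼-sym NP∼AZ ⟩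
    NP             ∎∼
    where
    τs = transpositionSum C y
    A = prodQS (map asym[_] As)
    B = prodQS (map asym[_] Bs)
    rows = prodQS (map sym[_] Rs)
    Z = asym[ C ] · (B · rows)
    NP = prodQS (map asym[_] As ++ asym[ C ] ∷ map asym[_] Bs) · rows
    NP∼AZ : NP ∼ A · Z
    NP∼AZ = ∼-trans (·-congˡ rows (prodQS-++ (map asym[_] As) (asym[ C ] ∷ map asym[_] Bs)))
              (∼-trans (·-assoc A (asym[ C ] · B) rows) (·-congʳ A (·-assoc asym[ C ] B rows)))

-- Tableaux

module _ {X : Set} where

  nth-∈ : ∀ (R : List X) b {x} → nth R b ≡ just x → x ∈ R
  nth-∈ (r ∷ R) zero    refl = here refl
  nth-∈ (r ∷ R) (suc b) e    = there (nth-∈ R b e)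

  nth-injective : ∀ (R : List X) {b b′ x} → Unique R → nth R b ≡ just x → nth R b′ ≡ just x → b ≡ b′
  nth-injective (r ∷ R) {zero}  {zero}   _          _    _  = refl
  nth-injective (r ∷ R) {zero}  {suc b′} (r∉ ∷ _)  refl e′ = ⊥-elim (All.lookup r∉ (nth-∈ R b′ e′) refl)
  nth-injective (r ∷ R) {suc b} {zero}   (r∉ ∷ _)  e    refl = ⊥-elim (All.lookup r∉ (nth-∈ R b e) refl)
  nth-injective (r ∷ R) {suc b} {suc b′} (_ ∷ u)   e    e′ = cong suc (nth-injective R u e e′)

  nth-just : ∀ (R : List X) {b} → b < length R → ∃ λ x → nth R b ≡ just x
  nth-just (r ∷ R) {zero}  _         = r , refl
  nth-just (r ∷ R) {suc b} (s<s b<) = nth-just R b<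

  nth-just⇒< : ∀ (R : List X) b {x} → nth R b ≡ just x → b < length R
  nth-just⇒< (r ∷ R) zero    _ = z<s
  nth-just⇒< (r ∷ R) (suc b) e = s<s (nth-just⇒< R b e)

  AtColumn : ℕ → X → List X → Set
  AtColumn b x R = nth R b ≡ just x

  ∈-col⁻ : ∀ (T : List (List X)) b {x} → x ∈ mapMaybe (λ r → nth r b) T → Any (AtColumn b x) T
  ∈-col⁻ (R ∷ T) b x∈ with nth R b in e
  ∈-col⁻ (R ∷ T) b (here refl) | just _ = here e
  ∈-col⁻ (R ∷ T) b (there x∈)  | just _ = there (∈-col⁻ T b x∈)
  ∈-col⁻ (R ∷ T) b x∈          | nothing = there (∈-col⁻ T b x∈)

  ∈-col⁺ : ∀ (T : List (List X)) b {x} → Any (AtColumn b x) T → x ∈ mapMaybe (λ r → nth r b) T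
  ∈-col⁺ (R ∷ T) b (here e) rewrite e = here refl
  ∈-col⁺ (R ∷ T) b (there a) with nth R b
  ... | just _  = there (∈-col⁺ T b a)
  ... | nothing = ∈-col⁺ T b a

  column-determined : ∀ (T : List (List X)) {b b′ x} → Unique (concat T) →
                      Any (AtColumn b x) T → Any (AtColumn b′ x) T → b ≡ b′
  column-determined (R ∷ T) {b} {b′} u at at′ with Unique-++⁻ R u
  column-determined (R ∷ T) u (here e)  (here e′)  | u-R , _ , _ = nth-injective R u-R e e′
  column-determined (R ∷ T) {b} {b′} u (here e) (there at′) | _ , _ , R#T =
    ⊥-elim (R#T (nth-∈ R b e , ∈-concat⁺ (nth-∈ _ b′) at′))
  column-determined (R ∷ T) {b} {b′} u (there at) (here e′) | _ , _ , R#T =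
    ⊥-elim (R#T (nth-∈ R b′ e′ , ∈-concat⁺ (nth-∈ _ b) at))
  column-determined (R ∷ T) u (there at) (there at′) | _ , u-T , _ = column-determined T u-T at at′

  col-unique : ∀ (T : List (List X)) b → Unique (concat T) → Unique (mapMaybe (λ r → nth r b) T)
  col-unique []      b _ = []
  col-unique (R ∷ T) b u with Unique-++⁻ R u
  ... | _ , u-T , R#T with nth R b in e
  ...   | just x  = All.tabulate (λ z∈ x≡z → R#T (nth-∈ R b e ,
                      subst (_∈ concat T) (sym x≡z) (∈-concat⁺ (nth-∈ _ b) (∈-col⁻ T b z∈))))
                    ∷ col-unique T b u-T
  ...   | nothing = col-unique T b u-T

  row-partner : ∀ (T : List (List X)) {i j z} → i < j → Any (AtColumn j z) T →
                ∃ λ w → Any (AtColumn i w) T × Any (λ R → w ∈ R × z ∈ R) T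
  row-partner (R ∷ T) {i} {j} i<j (here e) with nth-just R (ℕP.<-trans i<j (nth-just⇒< R j e))
  ... | w , e′ = w , here e′ , here (nth-∈ R i e′ , nth-∈ R j e)
  row-partner (R ∷ T) i<j (there at) with row-partner T i<j at
  ... | w , at′ , same-row = w , there at′ , there same-row

upTo-split : ∀ {L i} → i < L → ∃ λ pre → ∃ λ post →
             upTo L ≡ pre ++ i ∷ post × All (_< i) pre × All (i <_) post
upTo-split {suc L} {i} i<1+L with ℕP.<-cmp i L
... | tri< i<L _ _ with upTo-split i<L
...   | pre , post , split , below , above =
  pre , post ∷ʳ L ,
  trans (sym (ListP.upTo-∷ʳ L)) (trans (cong (_∷ʳ L) split) (ListP.++-assoc pre (i ∷ post) (L ∷ []))) ,
  below , AllP.++⁺ above (i<L ∷ [])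
upTo-split {suc L} {i} i<1+L | tri≈ _ refl _ = upTo L , [] , sym (ListP.upTo-∷ʳ L) , AllP.all-upTo L , []
upTo-split {suc L} {i} i<1+L | tri> _ _ i>L  = ⊥-elim (ℕP.<-irrefl refl (ℕP.<-≤-trans i>L (ℕP.≤-pred i<1+L)))

module _ {n : ℕ} (T : Tableau n) (entries-unique : Unique (concat T)) where

  col-disjoint : ∀ {b b′} → b ≢ b′ → Disjoint (col T b) (col T b′)
  col-disjoint b≢b′ (x∈b , x∈b′) =
    b≢b′ (column-determined T entries-unique (∈-col⁻ T _ x∈b) (∈-col⁻ T _ x∈b′))

  transpositionSum-·-NP : ∀ {i j y} → i < j → j < λ₁ T → y ∈ col T j →
                          transpositionSum (col T i) y · (N T · P T) ∼ N T · P T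
  transpositionSum-·-NP {i} {j} {y} i<j j<λ₁ y∈Cj with upTo-split (ℕP.<-trans i<j j<λ₁)
  ... | pre , post , split , below , above =
    subst (λ N′ → transpositionSum Ci y · (N′ · P T) ∼ N′ · P T) (sym N-split)
      (transpositionSum-·-columns (map (col T) pre) (map (col T) post) T
        (col-unique T i entries-unique) y∉Ci y∈Cj
        (AllP.map⁺ (All.map before below)) (AllP.map⁺ (All.map after above)) partner entries-unique)
    where
    Ci = col T i
    Cj = col T j
    N-split : N T ≡ prodQS (map asym[_] (map (col T) pre) ++ asym[ Ci ] ∷ map asym[_] (map (col T) post))
    N-split = cong prodQS (begin
      map (λ b → asym[ col T b ]) (upTo (λ₁ T))            ≡⟨ cong (map (λ b → asym[ col T b ])) split ⟩
      map (λ b → asym[ col T b ]) (pre ++ i ∷ post)        ≡⟨ ListP.map-++ (λ b → asym[ col T b ]) pre (i ∷ post) ⟩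
      map (λ b → asym[ col T b ]) pre ++ asym[ Ci ] ∷ map (λ b → asym[ col T b ]) post
        ≡⟨ cong₂ (λ u v → u ++ asym[ Ci ] ∷ v) (ListP.map-∘ pre) (ListP.map-∘ post) ⟩
      map asym[_] (map (col T) pre) ++ asym[ Ci ] ∷ map asym[_] (map (col T) post) ∎)
    y∉Ci : y ∉ Ci
    y∉Ci y∈Ci = col-disjoint (ℕP.<⇒≢ i<j) (y∈Ci , y∈Cj)
    before : ∀ {b} → b < i → Disjoint (col T b) (y ∷ Ci)
    before b<i (x∈b , here refl)  = col-disjoint (ℕP.<⇒≢ (ℕP.<-trans b<i i<j)) (x∈b , y∈Cj)
    before b<i (x∈b , there x∈Ci) = col-disjoint (ℕP.<⇒≢ b<i) (x∈b , x∈Ci)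
    after : ∀ {b} → i < b → Disjoint (col T b) Ci × (col T b ≡ Cj ⊎ Disjoint (col T b) Cj)
    after {b} i<b = (λ (x∈b , x∈Ci) → col-disjoint (ℕP.<⇒≢ i<b) (x∈Ci , x∈b)) , same-or-disjoint
      where
      same-or-disjoint : col T b ≡ Cj ⊎ Disjoint (col T b) Cj
      same-or-disjoint with b Nat.≟ j
      ... | yes refl = inj₁ refl
      ... | no b≢j   = inj₂ (col-disjoint b≢j)
    partner : ∀ {z} → z ∈ Cj → ∃ λ w → w ∈ Ci × Any (λ R → w ∈ R × z ∈ R) T
    partner z∈Cj with row-partner T i<j (∈-col⁻ T j z∈Cj)
    ... | w , at , same-row = w , ∈-col⁺ T i at , same-row

lemma4p6 : (n : ℕ) (T : Tableau n) → IsTableau n T →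
    (i j : ℕ) → i < j → j < λ₁ T →
    (k : Fin (length (col T j))) →
    α T i (lookup (col T j) k) · γ T ≈ γ T
lemma4p6 n T (_ , entries↭) i j i<j j<λ₁ k = ∼⇒≈ (begin∼
  α T i y · scale c (N T · P T)   ≈⟨ scale-·ʳ c (α T i y) (N T · P T) ⟩
  scale c (α T i y · (N T · P T)) ≈⟨ scale-cong c (transpositionSum-·-NP T entries-unique i<j j<λ₁ (∈-lookup k)) ⟩
  scale c (N T · P T)             ∎∼)
  where
  open SetoidReasoning (∼-setoid {n}) using (step-≈-⟩) renaming (begin_ to begin∼_; _∎ to _∎∼)
  y = lookup (col T j) k
  c = ℚ._/_ (ℤ.+ f n (shape T)) (n Nat.!) {{n ℕP.!≢0}}
  entries-unique : Unique (concat T)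
  entries-unique = PermSetoidP.Unique-resp-↭ (setoid (Fin n)) (↭⇒↭ₛ (↭-sym entries↭)) (allFin⁺ n)
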